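{- Let $q>1$ and $m>0$ be integers with $\gcd(q,m)=1$. Let $T$ be a positive integer which is a multiple of $\nu_m(q)$, and let $l\in\{0,1,2,\ldots\}$, $n\in\{1,2,3,\ldots\}$ and $r\in\mathbb{Z}$. Then $$\sum_{k=0}^n(-1)^k\binom nk\left[\begin{matrix} kT+l\\ r\end{matrix}\right]_m\equiv\begin{cases} 2^l(1-2^T)^n/m \pmod{q^n}&\text{if } m \text{ is odd},\\ \delta_{l,0}(-1)^r/m \pmod{q^n}&\text{if } m \text{ is even},\end{cases}$$ where $\delta_{l,0}$ equals $1$ if $l=0$ and $0$ otherwise.
   Context: For $m\in\mathbb{Z}^+$, $N\in\{0,1,2,\ldots\}$ and $r\in\mathbb{Z}$, $\left[\begin{matrix} N\\ r\end{matrix}\right]_m=\sum_{0\le k\le N,\ k\equiv r \pmod m}\binom Nk$. For integers $q>1$, $m>0$ with $\gcd(q,m)=1$, write $q=\prod_{s=1}^t p_s^{\alpha_s}$ with distinct primes $p_s$ and $\alpha_s\ge1$, and let $\beta_s$ be the multiplicative order of $p_s$ modulo $m$ (the least positive integer with $p_s^{\beta_s}\equiv1\pmod m$); then $\nu_m(q)=\operatorname{lcm}[p_1^{\alpha_1-1}(p_1^{\beta_1}-1),\ldots,p_t^{\alpha_t-1}(p_t^{\beta_t}-1)]$. Since $\gcd(m,q)=1$, division by $m$ in a congruence modulo $q^n$ means multiplication by the inverse of $m$ modulo $q^n$. -}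

module Defs where

open import Data.Nat as ℕ using (ℕ; zero; suc; _∸_; _<_; _≤_)
open import Data.Nat.Primality using (Prime)
open import Data.Nat.LCM using (lcm)
open import Data.Nat.Combinatorics using (_C_)
open import Data.Integer.Divisibility.Signed using () renaming (_∣?_ to _∣?ℤ_)
open import Data.Nat.DivMod using (_%_)
open import Data.Integer as ℤ using (ℤ; +_; -_)
open import Data.Integer.Divisibility using () renaming (_∣_ to _∣ℤ_)
open import Data.Integer.Properties using ()
open import Data.List using (List; map; foldr; upTo)
open import Data.List.Relation.Unary.All using (All)
open import Data.List.Relation.Unary.AllPairs using (AllPairs)
open import Data.Product using (_×_; _,_; Σ; proj₁)
open import Relation.Binary.PropositionalEquality using (_≡_; _≢_)
open import Relation.Nullary using (Dec; yes; no)
open import Relation.Nullary.Decidable using (⌊_⌋)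
open import Data.Bool using (if_then_else_)

Σ≤ : ℕ → (ℕ → ℤ) → ℤ
Σ≤ zero    f = f zero
Σ≤ (suc N) f = Σ≤ N f ℤ.+ f (suc N)

binomℤ : ℕ → ℕ → ℤ
binomℤ N k = + (N C k)

infix 4 _≡_[mod_]
_≡_[mod_] : ℤ → ℤ → ℕ → Set
a ≡ b [mod M ] = (+ M) ∣ℤ (a ℤ.- b)

binomSumMod : (m : ℕ) → ℕ → ℤ → ℤ
binomSumMod m N r = Σ≤ N (λ k → if ⌊ (+ m) ∣?ℤ ((+ k) ℤ.- r) ⌋ then binomℤ N k else + 0)

MultOrder : ℕ → ℕ → ℕ → Set
MultOrder m p β = (0 < β) × (ℕ._^_ p β ≡ 1 [modℕ m ]) × (∀ γ → 0 < γ → ℕ._^_ p γ ≡ 1 [modℕ m ] → β ≤ γ)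
  where
  _≡_[modℕ_] : ℕ → ℕ → ℕ → Set
  a ≡ b [modℕ M ] = (+ a) ≡ (+ b) [mod M ]

record NuData (m q : ℕ) : Set where
  field
    factors   : List (ℕ × ℕ × ℕ)
    primes    : All (λ { (p , α , β) → Prime p }) factors
    exps      : All (λ { (p , α , β) → 1 ≤ α }) factors
    distinct  : AllPairs (λ { (p , _) (p' , _) → p ≢ p' }) factors
    product   : foldr ℕ._*_ 1 (map (λ { (p , α , β) → ℕ._^_ p α }) factors) ≡ q
    orders    : All (λ { (p , α , β) → MultOrder m p β }) factors

ν : ∀ {m q} → NuData m q → ℕ
ν d = foldr lcm 1 (map (λ { (p , α , β) → ℕ._*_ (ℕ._^_ p (α ∸ 1)) (ℕ._^_ p β ∸ 1) }) (NuData.factors d))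

minusOnePow : ℤ → ℤ
minusOnePow r = if ⌊ (+ 2) ∣?ℤ r ⌋ then + 1 else - (+ 1)

δ0 : ℕ → ℤ
δ0 zero    = + 1
δ0 (suc _) = + 0

-- Work in R = ℤ[X]/(X^m − 1), realised as shift operators on m-periodic integer sequences: if δ is
-- the indicator of mℤ then [N r]_m = ((1 + X)^N δ)(r), and the alternating sum is
-- ((1 − A)^n (1 + X)^l δ)(r) with A = (1 + X)^T.  Take σ = 1 for odd m and σ = −1 for even m, and
-- let ε = Σ_{i<m} (σX)^i and u = m − ε.  Then Xε = σε, ε² = mε, u² = mu, and u is a multiple
-- of 1 + X.  For a prime power p^α ∥ q, with p^β ≡ 1 (mod m), Frobenius gives
-- (1 + X)^(p^β) ≡ 1 + X^(p^β) = 1 + X (mod p), hence u(1 + X)^(p^β − 1) ≡ u (mod p); lifting the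
-- exponent and cancelling powers of m (u^k = m^(k−1) u) gives u(1 + X)^(p^(α−1)(p^β − 1)) ≡ u
-- (mod p^α), and by the Chinese remainder theorem uA ≡ u (mod q).  So q^n divides
-- (u(1 − A))^n = m^(n−1) u (1 − A)^n, hence u (1 − A)^n, i.e.
-- m (1 − A)^n (1 + X)^l ≡ ε (1 − A)^n (1 + X)^l = (1 + σ)^l (1 − (1 + σ)^T)^n ε (mod q^n).
-- Finally εδ is the constant 1 for odd m and r ↦ (−1)^r for even m.

module Submission where

open import Defs
open import Data.Nat as ℕ using (ℕ; _<_; _≤_)
open import Data.Nat.Divisibility using (_∣_)
open import Data.Nat.Coprimality using (Coprime)
open import Relation.Nullary using (¬_)
open import Data.Integer as ℤ using (ℤ; +_; -_)
open import Data.Product using (_×_)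

open import Data.Nat using (zero; suc; s≤s; z≤n; _∸_; _!)
import Data.Nat.Properties as ℕₚ
import Data.Nat.Divisibility as ℕ∣
open import Data.Nat.Combinatorics using (_C_)
open import Data.Nat.Primality using (Prime; prime⇒nonZero; euclidsLemma; prime⇒irreducible; ¬prime[0]; ¬prime[1])
import Data.Nat.Combinatorics as Comb
import Data.Nat.DivMod as DivMod
import Data.Nat.Coprimality as Coprimality
open import Data.Nat.GCD using (module Bézout)
open import Data.Nat.LCM using (lcm; m∣lcm[m,n]; n∣lcm[m,n])
open import Data.List using (List; []; _∷_; map; foldr)
open import Data.List.Properties using (map-cong)
open import Data.List.Relation.Unary.All as All using (All; []; _∷_)
open import Data.List.Relation.Unary.AllPairs as AllPairs using (AllPairs; []; _∷_)
import Data.Integer.Properties as ℤₚ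
import Data.Integer.DivMod as ℤ/
open import Data.Integer.Tactic.RingSolver using (solve-∀)
open import Data.Nat.Tactic.RingSolver using () renaming (solve-∀ to solve-∀ℕ)
open import Data.Product using (∃; ∃₂; _,_; proj₁; proj₂)
open import Data.Sum using (_⊎_; inj₁; inj₂)
open import Data.Empty using (⊥-elim)
open import Algebra.Bundles using (CommutativeRing)
open import Algebra.Structures using (IsCommutativeRing)
open import Algebra.Morphism.Structures using (IsRingHomomorphism)
open import Algebra.Solver.Ring.AlmostCommutativeRing
  using (_-Raw-AlmostCommutative⟶_; Induced-equivalence; fromCommutativeRing)
open import Relation.Binary.Definitions using (WeaklyDecidable)
open import Level using (_⊔_; 0ℓ)
import Data.Maybe as Maybe
open import Relation.Nullary.Decidable using (Dec; yes; no; dec⇒maybe; ⌊_⌋; isYes≗does; dec-true; dec-false)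
open import Data.Bool using (true; false; if_then_else_)
open import Data.Integer.Divisibility.Signed as ℤ∣ using () renaming (_∣?_ to _∣?ℤ_)
import Relation.Binary.Reasoning.Setoid
open import Relation.Binary.PropositionalEquality
  using (_≡_; _≢_; refl; sym; trans; cong; cong₂; subst; module ≡-Reasoning)

-- Integer arithmetic

prime∤k! : ∀ {p} k → Prime p → k < p → ¬ (p ∣ k !)
prime∤k! zero pp _ p∣1 = ¬prime[1] (subst Prime (ℕ∣.∣1⇒≡1 p∣1) pp)
prime∤k! (suc k) pp k<p p∣k! with euclidsLemma (suc k) (k !) pp p∣k!
... | inj₁ p∣1+k = ℕₚ.<⇒≱ k<p (ℕ∣.∣⇒≤ p∣1+k)
... | inj₂ p∣k!  = prime∤k! k pp (ℕₚ.<-trans (ℕₚ.n<1+n k) k<p) p∣k!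

nCk*k!*[n∸k]!≡n! : ∀ {n k} → k ≤ n → (n C k) ℕ.* (k ! ℕ.* (n ∸ k) !) ≡ n !
nCk*k!*[n∸k]!≡n! {n} {k} k≤n =
  trans (cong (ℕ._* (k ! ℕ.* (n ∸ k) !)) (Comb.nCk≡n!/k![n-k]! k≤n)) (DivMod.m/n*n≡m (Comb.k![n∸k]!∣n! k≤n))
  where instance _ = k ℕₚ.!* (n ∸ k) !≢0

prime∣pCk : ∀ {p k} → Prime p → 0 < k → k < p → p ∣ p C k
prime∣pCk {p} {k} pp 0<k k<p
  with euclidsLemma (p C k) (k ! ℕ.* (p ∸ k) !) pp p∣C*denominator
  where
  p∣C*denominator : p ∣ (p C k) ℕ.* (k ! ℕ.* (p ∸ k) !)
  p∣C*denominator = subst (p ∣_) (sym (nCk*k!*[n∸k]!≡n! (ℕₚ.<⇒≤ k<p))) (n∣n! (ℕₚ.<-trans 0<k k<p))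
    where
    n∣n! : ∀ {n} → 0 < n → n ∣ n !
    n∣n! {suc n} _ = ℕ∣.m∣m*n (n !)
... | inj₁ p∣C = p∣C
... | inj₂ p∣denominator with euclidsLemma (k !) ((p ∸ k) !) pp p∣denominator
...   | inj₁ p∣k! = ⊥-elim (prime∤k! k pp k<p p∣k!)
...   | inj₂ p∣[p∸k]! = ⊥-elim (prime∤k! (p ∸ k) pp (ℕₚ.∸-monoʳ-< 0<k (ℕₚ.<⇒≤ k<p)) p∣[p∸k]!)

pos-^ : ∀ a n → + (a ℕ.^ n) ≡ (+ a) ℤ.^ n
pos-^ a zero    = refl
pos-^ a (suc n) = trans (ℤₚ.pos-* a (a ℕ.^ n)) (cong (+ a ℤ.*_) (pos-^ a n))

distinct-primes⇒coprime : ∀ {p p′} → Prime p → Prime p′ → p ≢ p′ → Coprime p p′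
distinct-primes⇒coprime pp pp′ p≢p′ {d} (d∣p , d∣p′) with prime⇒irreducible pp d∣p
... | inj₁ d≡1 = d≡1
... | inj₂ refl with prime⇒irreducible pp′ d∣p′
...   | inj₁ p≡1  = ⊥-elim (¬prime[1] (subst Prime p≡1 pp))
...   | inj₂ p≡p′ = ⊥-elim (p≢p′ p≡p′)

Comaximal : ℤ → ℤ → Set
Comaximal a b = ∃₂ λ s t → s ℤ.* a ℤ.+ t ℤ.* b ≡ + 1

private
  ℕ-bézout⇒ℤ-bézout : ∀ {a b} x y → 1 ℕ.+ y ℕ.* b ≡ x ℕ.* a → + x ℤ.* + a ℤ.+ - + y ℤ.* + b ≡ + 1
  ℕ-bézout⇒ℤ-bézout {a} {b} x y 1+yb≡xa = begin
    + x ℤ.* + a ℤ.+ - + y ℤ.* + b             ≡⟨ cong (λ u → u ℤ.+ - + y ℤ.* + b) (ℤₚ.pos-* x a) ⟨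
    + (x ℕ.* a) ℤ.+ - + y ℤ.* + b             ≡⟨ cong (λ u → + u ℤ.+ - + y ℤ.* + b) 1+yb≡xa ⟨
    + (1 ℕ.+ y ℕ.* b) ℤ.+ - + y ℤ.* + b       ≡⟨ cong (λ u → u ℤ.+ - + y ℤ.* + b) 1+yb≡1+y*b ⟩
    + 1 ℤ.+ + y ℤ.* + b ℤ.+ - + y ℤ.* + b     ≡⟨ cancel (+ y) (+ b) ⟩
    + 1                                       ∎
    where
    open ≡-Reasoning
    1+yb≡1+y*b : + (1 ℕ.+ y ℕ.* b) ≡ + 1 ℤ.+ + y ℤ.* + b
    1+yb≡1+y*b = trans (ℤₚ.pos-+ 1 (y ℕ.* b)) (cong (λ v → + 1 ℤ.+ v) (ℤₚ.pos-* y b))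
    cancel : ∀ y b → + 1 ℤ.+ y ℤ.* b ℤ.+ - y ℤ.* b ≡ + 1
    cancel = solve-∀

coprime⇒comaximal : ∀ {a b} → Coprime a b → Comaximal (+ a) (+ b)
coprime⇒comaximal {a} {b} a⊥b with Coprimality.coprime-Bézout a⊥b
... | Bézout.+- x y 1+yb≡xa = + x , - + y , ℕ-bézout⇒ℤ-bézout x y 1+yb≡xa
... | Bézout.-+ x y 1+xa≡yb =
  - + x , + y , trans (ℤₚ.+-comm (- + x ℤ.* + a) (+ y ℤ.* + b)) (ℕ-bézout⇒ℤ-bézout y x 1+xa≡yb)

comaximal-sym : ∀ {a b} → Comaximal a b → Comaximal b a
comaximal-sym {a} {b} (s , t , eq) = t , s , trans (ℤₚ.+-comm (t ℤ.* b) (s ℤ.* a)) eq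

comaximal-*ˡ : ∀ {a b c} → Comaximal a c → Comaximal b c → Comaximal (a ℤ.* b) c
comaximal-*ˡ {a} {b} {c} (s , t , sa+tc≡1) (s′ , t′ , s′b+t′c≡1) =
  s ℤ.* s′ , s ℤ.* a ℤ.* t′ ℤ.+ t ℤ.* s′ ℤ.* b ℤ.+ t ℤ.* t′ ℤ.* c ,
  trans (expand s a t c s′ b t′) (cong₂ ℤ._*_ sa+tc≡1 s′b+t′c≡1)
  where
  expand : ∀ s a t c s′ b t′ →
    s ℤ.* s′ ℤ.* (a ℤ.* b) ℤ.+ (s ℤ.* a ℤ.* t′ ℤ.+ t ℤ.* s′ ℤ.* b ℤ.+ t ℤ.* t′ ℤ.* c) ℤ.* c
      ≡ (s ℤ.* a ℤ.+ t ℤ.* c) ℤ.* (s′ ℤ.* b ℤ.+ t′ ℤ.* c)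
  expand = solve-∀

comaximal-^ˡ : ∀ {a c} n → Comaximal a c → Comaximal (a ℤ.^ n) c
comaximal-^ˡ zero    _   = + 1 , + 0 , refl
comaximal-^ˡ (suc n) a⊥c = comaximal-*ˡ a⊥c (comaximal-^ˡ n a⊥c)

comaximal-^ : ∀ {a c} n k → Comaximal a c → Comaximal (a ℤ.^ n) (c ℤ.^ k)
comaximal-^ n k a⊥c = comaximal-^ˡ n (comaximal-sym (comaximal-^ˡ k (comaximal-sym a⊥c)))

≡1[mod]⇒≡1+multiple : ∀ {M N} → 0 < N → + N ≡ + 1 [mod M ] → ∃ λ t → N ≡ suc (t ℕ.* M)
≡1[mod]⇒≡1+multiple {N = suc N} _ (ℕ∣.divides t N≡tM) = t , cong suc N≡tM

Factor : Set
Factor = ℕ × ℕ × ℕ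

PrimePowerFactor : ℕ → Factor → Set
PrimePowerFactor m (p , α , β) = Prime p × 1 ≤ α × MultOrder m p β

DistinctPrimes : Factor → Factor → Set
DistinctPrimes (p , _) (p′ , _) = p ≢ p′

factorPower : Factor → ℕ
factorPower (p , α , _) = p ℕ.^ α

factorν : Factor → ℕ
factorν (p , α , β) = p ℕ.^ (α ∸ 1) ℕ.* (p ℕ.^ β ∸ 1)

∏ : List Factor → ℕ
∏ L = foldr ℕ._*_ 1 (map factorPower L)

lcmν : List Factor → ℕ
lcmν L = foldr lcm 1 (map factorν L)

-- The fields of NuData use anonymous pattern-matching predicates, which do not reduce on a variable
-- factor; these restate them with named ones, so that the factor list can be inducted over.
module _ {m q} (d : NuData m q) where
  open NuData d

  factors-valid : All (PrimePowerFactor m) factors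
  factors-valid =
    All.zipWith (λ { {p , α , β} (pp , α≥1 , order) → pp , α≥1 , order }) (primes , All.zip (exps , orders))

  factors-distinct : AllPairs DistinctPrimes factors
  factors-distinct = AllPairs.map (λ { {p , _} {p′ , _} p≢p′ → p≢p′ }) distinct

  ∏-factors : ∏ factors ≡ q
  ∏-factors = trans (cong (foldr ℕ._*_ 1) (map-cong (λ { (p , α , β) → refl }) factors)) product

  ν≡lcmν : ν d ≡ lcmν factors
  ν≡lcmν = cong (foldr lcm 1) (map-cong (λ { (p , α , β) → refl }) factors)

comaximal-∏ : ∀ {m p α β} → Prime p → ∀ {L} → All (PrimePowerFactor m) L → All (DistinctPrimes (p , α , β)) L →
              Comaximal (+ p) (+ ∏ L)
comaximal-∏ pp [] [] = + 0 , + 1 , refl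
comaximal-∏ {m} {p} {α} {β} pp {(p′ , α′ , β′) ∷ L} ((pp′ , _) ∷ valid) (p≢p′ ∷ distinct) =
  subst (Comaximal (+ p)) (trans (cong (ℤ._* + ∏ L) (sym (pos-^ p′ α′))) (sym (ℤₚ.pos-* (p′ ℕ.^ α′) (∏ L))))
    (comaximal-sym (comaximal-*ˡ (comaximal-^ˡ α′ (comaximal-sym p⊥p′))
                                 (comaximal-sym (comaximal-∏ {m} {p} {α} {β} pp valid distinct))))
  where
  p⊥p′ : Comaximal (+ p) (+ p′)
  p⊥p′ = coprime⇒comaximal (distinct-primes⇒coprime pp pp′ p≢p′)

-- Commutative ℤ-algebras

module IntegerAlgebra
  {c ℓ} (R : CommutativeRing c ℓ) (ι : ℤ → CommutativeRing.Carrier R)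
  (ι-isRingHomomorphism : IsRingHomomorphism ℤ.+-*-rawRing (CommutativeRing.rawRing R) ι)
  where

  open CommutativeRing R public
    renaming ( _+_ to _⊕_; _*_ to _⊗_; -_ to ⊝_; _-_ to _⊖_; 0# to 𝟘; 1# to 𝟙
             ; refl to ≈-refl; sym to ≈-sym; trans to ≈-trans; reflexive to ≈-reflexive
             ; +-cong to ⊕-cong; *-cong to ⊗-cong; -‿cong to ⊝-cong )
  open import Algebra.Properties.Semiring.Exp semiring public using (_^_; ^-congˡ; ^-congʳ; ^-homo-*; ^-assocʳ)
  open import Algebra.Properties.CommutativeSemiring.Exp commutativeSemiring public using (^-distrib-*)
  open IsRingHomomorphism ι-isRingHomomorphism public
    using () renaming (+-homo to ι-+; *-homo to ι-*; -‿homo to ι-⊝; 0#-homo to ι-0; 1#-homo to ι-1)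
  module ≈-Reasoning = Relation.Binary.Reasoning.Setoid setoid
  open ≈-Reasoning

  private
    ι-morphism : ℤ.+-*-rawRing -Raw-AlmostCommutative⟶ fromCommutativeRing R
    ι-morphism = record
      { ⟦_⟧ = ι ; +-homo = ι-+ ; *-homo = ι-* ; -‿homo = ι-⊝ ; 0-homo = ι-0 ; 1-homo = ι-1 }

    ι-≟ : WeaklyDecidable (Induced-equivalence ι-morphism)
    ι-≟ a b = Maybe.map (λ a≡b → ≈-reflexive (cong ι a≡b)) (dec⇒maybe (a ℤ.≟ b))

  open import Algebra.Solver.Ring ℤ.+-*-rawRing (fromCommutativeRing R) ι-morphism ι-≟ public
    using (Polynomial; solve; _:=_; _:+_; _:*_; _:-_; :-_; con; _:^_)

  -- The solver reads `con c` as `ι c`, which is only equivalent to 1#; `con (+ 1) :^ 0` is 1# itself.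
  𝟏 : ∀ {n} → Polynomial n
  𝟏 = con (+ 1) :^ 0

  ι-≡ : ∀ {a b} → a ≡ b → ι a ≈ ι b
  ι-≡ a≡b = ≈-reflexive (cong ι a≡b)

  ι-^ : ∀ k n → ι (k ℤ.^ n) ≈ ι k ^ n
  ι-^ k zero    = ι-1
  ι-^ k (suc n) = ≈-trans (ι-* k (k ℤ.^ n)) (*-congˡ (ι-^ k n))

  ι-suc : ∀ n → ι (+ suc n) ≈ ι (+ n) ⊕ 𝟙
  ι-suc n = ≈-trans (ι-≡ (trans (cong +_ (ℕₚ.+-comm 1 n)) (ℤₚ.pos-+ n 1))) (≈-trans (ι-+ (+ n) (+ 1)) (+-congˡ ι-1))

  ι1-identityˡ : ∀ a → ι (+ 1) ⊗ a ≈ a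
  ι1-identityˡ a = ≈-trans (*-congʳ ι-1) (*-identityˡ a)

  ∑< : ℕ → (ℕ → Carrier) → Carrier
  ∑< zero    f = 𝟘
  ∑< (suc n) f = ∑< n f ⊕ f n

  syntax ∑< n (λ i → e) = ∑[ i < n ] e

  ∑<-cong : ∀ n {f g} → (∀ i → f i ≈ g i) → ∑< n f ≈ ∑< n g
  ∑<-cong zero    f≈g = ≈-refl
  ∑<-cong (suc n) f≈g = ⊕-cong (∑<-cong n f≈g) (f≈g n)

  ∑<-suc : ∀ n f → ∑< (suc n) f ≈ f 0 ⊕ ∑[ i < n ] (f (suc i))
  ∑<-suc zero    f = +-comm 𝟘 (f 0)
  ∑<-suc (suc n) f = ≈-trans (+-congʳ (∑<-suc n f)) (+-assoc (f 0) _ (f (suc n)))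

  ∑<-⊕ : ∀ n f g → ∑[ i < n ] (f i ⊕ g i) ≈ ∑< n f ⊕ ∑< n g
  ∑<-⊕ zero    f g = ≈-sym (+-identityˡ 𝟘)
  ∑<-⊕ (suc n) f g = ≈-trans (+-congʳ (∑<-⊕ n f g)) (interchange _ _ _ _)
    where
    interchange : ∀ a b c d → (a ⊕ b) ⊕ (c ⊕ d) ≈ (a ⊕ c) ⊕ (b ⊕ d)
    interchange = solve 4 (λ a b c d → (a :+ b) :+ (c :+ d) := (a :+ c) :+ (b :+ d)) ≈-refl

  *-distribˡ-∑< : ∀ n a f → a ⊗ ∑< n f ≈ ∑[ i < n ] (a ⊗ f i)
  *-distribˡ-∑< zero    a f = zeroʳ a
  *-distribˡ-∑< (suc n) a f = ≈-trans (distribˡ a (∑< n f) (f n)) (+-congʳ (*-distribˡ-∑< n a f))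

  *-distribʳ-∑< : ∀ n a f → ∑< n f ⊗ a ≈ ∑[ i < n ] (f i ⊗ a)
  *-distribʳ-∑< n a f =
    ≈-trans (*-comm (∑< n f) a) (≈-trans (*-distribˡ-∑< n a f) (∑<-cong n (λ i → *-comm a (f i))))

  ∑<-const : ∀ n a → ∑[ i < n ] (a) ≈ ι (+ n) ⊗ a
  ∑<-const zero    a = ≈-trans (≈-sym (zeroˡ a)) (*-congʳ (≈-sym ι-0))
  ∑<-const (suc n) a = begin
    ∑[ i < n ] (a) ⊕ a        ≈⟨ +-congʳ (∑<-const n a) ⟩
    ι (+ n) ⊗ a ⊕ a           ≈⟨ step (ι (+ n)) a ⟩
    (ι (+ n) ⊕ 𝟙) ⊗ a         ≈⟨ *-congʳ (ι-suc n) ⟨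
    ι (+ suc n) ⊗ a           ∎
    where
    step : ∀ N a → N ⊗ a ⊕ a ≈ (N ⊕ 𝟙) ⊗ a
    step = solve 2 (λ N a → N :* a :+ a := (N :+ 𝟏) :* a) ≈-refl

  binomial : ∀ a n → (𝟙 ⊕ a) ^ n ≈ ∑[ k < suc n ] (ι (+ (n C k)) ⊗ a ^ k)
  binomial a zero    = ≈-sym (≈-trans (+-identityˡ _) (ι1-identityˡ 𝟙))
  binomial a (suc n) = begin
    (𝟙 ⊕ a) ⊗ (𝟙 ⊕ a) ^ n                               ≈⟨ *-congˡ (binomial a n) ⟩
    (𝟙 ⊕ a) ⊗ ∑< (suc n) (B n)                          ≈⟨ distribʳ _ 𝟙 a ⟩
    𝟙 ⊗ ∑< (suc n) (B n) ⊕ a ⊗ ∑< (suc n) (B n)         ≈⟨ +-congʳ (*-identityˡ _) ⟩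
    ∑< (suc n) (B n) ⊕ a ⊗ ∑< (suc n) (B n)             ≈⟨ ⊕-cong shifted (*-distribˡ-∑< (suc n) a (B n)) ⟩
    (B n 0 ⊕ ∑[ k < suc n ] (B n (suc k))) ⊕ ∑[ k < suc n ] (a ⊗ B n k)
                                                         ≈⟨ regroup _ _ _ ⟩
    B n 0 ⊕ (∑[ k < suc n ] (a ⊗ B n k) ⊕ ∑[ k < suc n ] (B n (suc k)))
                                                         ≈⟨ +-congˡ (≈-sym (∑<-⊕ (suc n) _ _)) ⟩
    B n 0 ⊕ ∑[ k < suc n ] (a ⊗ B n k ⊕ B n (suc k))    ≈⟨ +-congˡ (∑<-cong (suc n) pascal) ⟩
    B (suc n) 0 ⊕ ∑[ k < suc n ] (B (suc n) (suc k))      ≈⟨ ≈-sym (∑<-suc (suc n) (B (suc n))) ⟩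
    ∑< (suc (suc n)) (B (suc n))                         ∎
    where
    B : ℕ → ℕ → Carrier
    B n k = ι (+ (n C k)) ⊗ a ^ k

    regroup : ∀ x y z → (x ⊕ y) ⊕ z ≈ x ⊕ (z ⊕ y)
    regroup = solve 3 (λ x y z → (x :+ y) :+ z := x :+ (z :+ y)) ≈-refl

    top-vanishes : B n (suc n) ≈ 𝟘
    top-vanishes = begin
      ι (+ (n C suc n)) ⊗ a ^ suc n ≈⟨ *-congʳ (ι-≡ (cong +_ (Comb.k>n⇒nCk≡0 (ℕₚ.n<1+n n)))) ⟩
      ι (+ 0) ⊗ a ^ suc n           ≈⟨ *-congʳ ι-0 ⟩
      𝟘 ⊗ a ^ suc n                 ≈⟨ zeroˡ _ ⟩
      𝟘                             ∎

    shifted : ∑< (suc n) (B n) ≈ B n 0 ⊕ ∑[ k < suc n ] (B n (suc k))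
    shifted = begin
      ∑< (suc n) (B n)                 ≈⟨ +-identityʳ _ ⟨
      ∑< (suc n) (B n) ⊕ 𝟘             ≈⟨ +-congˡ top-vanishes ⟨
      ∑< (suc (suc n)) (B n)           ≈⟨ ∑<-suc (suc n) (B n) ⟩
      B n 0 ⊕ ∑[ k < suc n ] (B n (suc k)) ∎

    pascal : ∀ k → a ⊗ B n k ⊕ B n (suc k) ≈ B (suc n) (suc k)
    pascal k = begin
      a ⊗ (ι (+ (n C k)) ⊗ a ^ k) ⊕ ι (+ (n C suc k)) ⊗ a ^ suc k
        ≈⟨ factor a (ι (+ (n C k))) (ι (+ (n C suc k))) (a ^ k) ⟩
      (ι (+ (n C k)) ⊕ ι (+ (n C suc k))) ⊗ a ^ suc k
        ≈⟨ *-congʳ (≈-sym (ι-+ _ _)) ⟩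
      ι (+ (n C k) ℤ.+ + (n C suc k)) ⊗ a ^ suc k
        ≈⟨ *-congʳ (ι-≡ (trans (sym (ℤₚ.pos-+ (n C k) _)) (cong +_ (Comb.nCk+nC[k+1]≡[n+1]C[k+1] n k)))) ⟩
      ι (+ (suc n C suc k)) ⊗ a ^ suc k
        ∎
      where
      factor : ∀ a c d p → a ⊗ (c ⊗ p) ⊕ d ⊗ (a ⊗ p) ≈ (c ⊕ d) ⊗ (a ⊗ p)
      factor = solve 4 (λ a c d p → a :* (c :* p) :+ d :* (a :* p) := (c :+ d) :* (a :* p)) ≈-refl

  infix 4 _∣ᴿ_ _≈_[mod_]

  _∣ᴿ_ : ℤ → Carrier → Set (c ⊔ ℓ)
  k ∣ᴿ a = ∃ λ w → a ≈ ι k ⊗ w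

  _≈_[mod_] : Carrier → Carrier → ℤ → Set (c ⊔ ℓ)
  a ≈ b [mod k ] = k ∣ᴿ a ⊖ b

  ∣ᴿ-resp-≈ : ∀ {k a b} → a ≈ b → k ∣ᴿ a → k ∣ᴿ b
  ∣ᴿ-resp-≈ a≈b (w , a≈kw) = w , ≈-trans (≈-sym a≈b) a≈kw

  ∣ᴿ-ι⊗ : ∀ k a → k ∣ᴿ ι k ⊗ a
  ∣ᴿ-ι⊗ k a = a , ≈-refl

  ∣ᴿ-𝟘 : ∀ k → k ∣ᴿ 𝟘
  ∣ᴿ-𝟘 k = 𝟘 , ≈-sym (zeroʳ (ι k))

  ∣ᴿ-⊕ : ∀ {k a b} → k ∣ᴿ a → k ∣ᴿ b → k ∣ᴿ a ⊕ b
  ∣ᴿ-⊕ {k} (w , a≈kw) (w′ , b≈kw′) = w ⊕ w′ , ≈-trans (⊕-cong a≈kw b≈kw′) (≈-sym (distribˡ (ι k) w w′))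

  ∣ᴿ-⊗ˡ : ∀ {k a} b → k ∣ᴿ a → k ∣ᴿ b ⊗ a
  ∣ᴿ-⊗ˡ {k} b (w , a≈kw) = b ⊗ w , ≈-trans (*-congˡ a≈kw) (swap b (ι k) w)
    where
    swap : ∀ x y z → x ⊗ (y ⊗ z) ≈ y ⊗ (x ⊗ z)
    swap = solve 3 (λ x y z → x :* (y :* z) := y :* (x :* z)) ≈-refl

  ∣ᴿ-⊗ʳ : ∀ {k a} b → k ∣ᴿ a → k ∣ᴿ a ⊗ b
  ∣ᴿ-⊗ʳ {a = a} b k∣a = ∣ᴿ-resp-≈ (*-comm b a) (∣ᴿ-⊗ˡ b k∣a)

  ∣ᴿ-⊝ : ∀ {k a} → k ∣ᴿ a → k ∣ᴿ ⊝ a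
  ∣ᴿ-⊝ {a = a} k∣a = ∣ᴿ-resp-≈ (negation a) (∣ᴿ-⊗ˡ (⊝ 𝟙) k∣a)
    where
    negation : ∀ a → ⊝ 𝟙 ⊗ a ≈ ⊝ a
    negation = solve 1 (λ a → :- 𝟏 :* a := :- a) ≈-refl

  ∣ᴿ-⊗ : ∀ {k l a b} → k ∣ᴿ a → l ∣ᴿ b → k ℤ.* l ∣ᴿ a ⊗ b
  ∣ᴿ-⊗ {k} {l} (w , a≈kw) (w′ , b≈lw′) =
    w ⊗ w′ , ≈-trans (⊗-cong a≈kw b≈lw′) (≈-trans (interchange (ι k) w (ι l) w′) (*-congʳ (≈-sym (ι-* k l))))
    where
    interchange : ∀ x y z t → (x ⊗ y) ⊗ (z ⊗ t) ≈ (x ⊗ z) ⊗ (y ⊗ t)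
    interchange = solve 4 (λ x y z t → (x :* y) :* (z :* t) := (x :* z) :* (y :* t)) ≈-refl

  ∣ᴿ-weaken : ∀ {k l a} → k ℤ.* l ∣ᴿ a → k ∣ᴿ a
  ∣ᴿ-weaken {k} {l} (w , a≈klw) =
    ι l ⊗ w , ≈-trans a≈klw (≈-trans (*-congʳ (ι-* k l)) (*-assoc (ι k) (ι l) w))

  ∣ᴿ-^ : ∀ {k a} n → k ∣ᴿ a → k ℤ.^ n ∣ᴿ a ^ n
  ∣ᴿ-^ zero    _   = 𝟙 , ≈-sym (ι1-identityˡ 𝟙)
  ∣ᴿ-^ (suc n) k∣a = ∣ᴿ-⊗ k∣a (∣ᴿ-^ n k∣a)

  ∣ᴿ-∑< : ∀ {k} n f → (∀ i → i < n → k ∣ᴿ f i) → k ∣ᴿ ∑< n f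
  ∣ᴿ-∑< zero    f _       = ∣ᴿ-𝟘 _
  ∣ᴿ-∑< (suc n) f k∣f[i] = ∣ᴿ-⊕ (∣ᴿ-∑< n f (λ i i<n → k∣f[i] i (ℕₚ.m<n⇒m<1+n i<n))) (k∣f[i] n (ℕₚ.n<1+n n))

  private
    bézout-split : ∀ {k l s t} a → s ℤ.* k ℤ.+ t ℤ.* l ≡ + 1 → a ≈ ι s ⊗ (ι k ⊗ a) ⊕ ι t ⊗ (ι l ⊗ a)
    bézout-split {k} {l} {s} {t} a sk+tl≡1 = begin
      a                                   ≈⟨ *-identityˡ a ⟨
      𝟙 ⊗ a                               ≈⟨ *-congʳ (≈-trans (≈-sym ι-1) (ι-≡ (sym sk+tl≡1))) ⟩
      ι (s ℤ.* k ℤ.+ t ℤ.* l) ⊗ a         ≈⟨ *-congʳ (≈-trans (ι-+ _ _) (⊕-cong (ι-* s k) (ι-* t l))) ⟩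
      (ι s ⊗ ι k ⊕ ι t ⊗ ι l) ⊗ a         ≈⟨ expand (ι s) (ι k) (ι t) (ι l) a ⟩
      ι s ⊗ (ι k ⊗ a) ⊕ ι t ⊗ (ι l ⊗ a)   ∎
      where
      expand : ∀ s k t l a → (s ⊗ k ⊕ t ⊗ l) ⊗ a ≈ s ⊗ (k ⊗ a) ⊕ t ⊗ (l ⊗ a)
      expand = solve 5 (λ s k t l a → (s :* k :+ t :* l) :* a := s :* (k :* a) :+ t :* (l :* a)) ≈-refl

  ∣ᴿ-crt : ∀ {k l a} → Comaximal k l → k ∣ᴿ a → l ∣ᴿ a → k ℤ.* l ∣ᴿ a
  ∣ᴿ-crt {k} {l} {a} (s , t , sk+tl≡1) (w , a≈kw) (w′ , a≈lw′) = ι s ⊗ w′ ⊕ ι t ⊗ w , (begin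
    a                                               ≈⟨ bézout-split a sk+tl≡1 ⟩
    ι s ⊗ (ι k ⊗ a) ⊕ ι t ⊗ (ι l ⊗ a)               ≈⟨ ⊕-cong (*-congˡ (*-congˡ a≈lw′)) (*-congˡ (*-congˡ a≈kw)) ⟩
    ι s ⊗ (ι k ⊗ (ι l ⊗ w′)) ⊕ ι t ⊗ (ι l ⊗ (ι k ⊗ w)) ≈⟨ regroup (ι s) (ι k) (ι t) (ι l) w w′ ⟩
    (ι k ⊗ ι l) ⊗ (ι s ⊗ w′ ⊕ ι t ⊗ w)               ≈⟨ *-congʳ (ι-* k l) ⟨
    ι (k ℤ.* l) ⊗ (ι s ⊗ w′ ⊕ ι t ⊗ w)               ∎)
    where
    regroup : ∀ s k t l w w′ → s ⊗ (k ⊗ (l ⊗ w′)) ⊕ t ⊗ (l ⊗ (k ⊗ w)) ≈ (k ⊗ l) ⊗ (s ⊗ w′ ⊕ t ⊗ w)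
    regroup = solve 6 (λ s k t l w w′ → s :* (k :* (l :* w′)) :+ t :* (l :* (k :* w))
                                       := (k :* l) :* (s :* w′ :+ t :* w)) ≈-refl

  ∣ᴿ-cancel : ∀ {k c a} → Comaximal k c → k ∣ᴿ ι c ⊗ a → k ∣ᴿ a
  ∣ᴿ-cancel {k} {c} {a} (s , t , sk+tc≡1) (w , ca≈kw) = ι s ⊗ a ⊕ ι t ⊗ w , (begin
    a                                   ≈⟨ bézout-split a sk+tc≡1 ⟩
    ι s ⊗ (ι k ⊗ a) ⊕ ι t ⊗ (ι c ⊗ a)   ≈⟨ +-congˡ (*-congˡ ca≈kw) ⟩
    ι s ⊗ (ι k ⊗ a) ⊕ ι t ⊗ (ι k ⊗ w)   ≈⟨ regroup (ι s) (ι k) (ι t) a w ⟩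
    ι k ⊗ (ι s ⊗ a ⊕ ι t ⊗ w)           ∎)
    where
    regroup : ∀ s k t a w → s ⊗ (k ⊗ a) ⊕ t ⊗ (k ⊗ w) ≈ k ⊗ (s ⊗ a ⊕ t ⊗ w)
    regroup = solve 5 (λ s k t a w → s :* (k :* a) :+ t :* (k :* w) := k :* (s :* a :+ t :* w)) ≈-refl

  ≈⇒≈[mod] : ∀ {a b} k → a ≈ b → a ≈ b [mod k ]
  ≈⇒≈[mod] {a} {b} k a≈b = ∣ᴿ-resp-≈ (≈-sym (≈-trans (+-congˡ (⊝-cong (≈-sym a≈b))) (-‿inverseʳ a))) (∣ᴿ-𝟘 k)

  ≈[mod]-resp : ∀ {k a a′ b b′} → a ≈ a′ → b ≈ b′ → a ≈ b [mod k ] → a′ ≈ b′ [mod k ]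
  ≈[mod]-resp a≈a′ b≈b′ = ∣ᴿ-resp-≈ (⊕-cong a≈a′ (⊝-cong b≈b′))

  ≈[mod]-trans : ∀ {k a b c} → a ≈ b [mod k ] → b ≈ c [mod k ] → a ≈ c [mod k ]
  ≈[mod]-trans {a = a} {b} {c} a≡b b≡c = ∣ᴿ-resp-≈ (telescope a b c) (∣ᴿ-⊕ a≡b b≡c)
    where
    telescope : ∀ a b c → (a ⊖ b) ⊕ (b ⊖ c) ≈ a ⊖ c
    telescope = solve 3 (λ a b c → (a :- b) :+ (b :- c) := a :- c) ≈-refl

  ≈[mod]-⊗ˡ : ∀ {k a b} c → a ≈ b [mod k ] → c ⊗ a ≈ c ⊗ b [mod k ]
  ≈[mod]-⊗ˡ {a = a} {b} c a≡b = ∣ᴿ-resp-≈ (expand c a b) (∣ᴿ-⊗ˡ c a≡b)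
    where
    expand : ∀ c a b → c ⊗ (a ⊖ b) ≈ c ⊗ a ⊖ c ⊗ b
    expand = solve 3 (λ c a b → c :* (a :- b) := c :* a :- c :* b) ≈-refl

  ≈[mod]-^ : ∀ {k a b} n → a ≈ b [mod k ] → a ^ n ≈ b ^ n [mod k ]
  ≈[mod]-^ {k} zero    _   = ≈⇒≈[mod] k ≈-refl
  ≈[mod]-^ {k} {a} {b} (suc n) a≡b =
    ∣ᴿ-resp-≈ (split a b (a ^ n) (b ^ n)) (∣ᴿ-⊕ (∣ᴿ-⊗ˡ a (≈[mod]-^ n a≡b)) (∣ᴿ-⊗ʳ (b ^ n) a≡b))
    where
    split : ∀ a b A B → a ⊗ (A ⊖ B) ⊕ (a ⊖ b) ⊗ B ≈ a ⊗ A ⊖ b ⊗ B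
    split = solve 4 (λ a b A B → a :* (A :- B) :+ (a :- b) :* B := a :* A :- b :* B) ≈-refl

  ≈[mod]-⊕ : ∀ {k a b c d} → a ≈ b [mod k ] → c ≈ d [mod k ] → a ⊕ c ≈ b ⊕ d [mod k ]
  ≈[mod]-⊕ {a = a} {b} {c} {d} a≡b c≡d = ∣ᴿ-resp-≈ (regroup a b c d) (∣ᴿ-⊕ a≡b c≡d)
    where
    regroup : ∀ a b c d → (a ⊖ b) ⊕ (c ⊖ d) ≈ (a ⊕ c) ⊖ (b ⊕ d)
    regroup = solve 4 (λ a b c d → (a :- b) :+ (c :- d) := (a :+ c) :- (b :+ d)) ≈-refl

  ∣⇒ι∣ᴿ : ∀ {p n} → p ∣ n → ∀ a → + p ∣ᴿ ι (+ n) ⊗ a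
  ∣⇒ι∣ᴿ {p} (ℕ∣.divides c n≡c*p) a = ι (+ c) ⊗ a , (begin
    ι (+ _) ⊗ a                ≈⟨ *-congʳ (ι-≡ (trans (cong +_ (trans n≡c*p (ℕₚ.*-comm c p))) (ℤₚ.pos-* p c))) ⟩
    ι (+ p ℤ.* + c) ⊗ a        ≈⟨ *-congʳ (ι-* (+ p) (+ c)) ⟩
    (ι (+ p) ⊗ ι (+ c)) ⊗ a    ≈⟨ *-assoc _ _ a ⟩
    ι (+ p) ⊗ (ι (+ c) ⊗ a)    ∎)

  freshman : ∀ {p} → Prime p → ∀ a → (𝟙 ⊕ a) ^ p ≈ 𝟙 ⊕ a ^ p [mod + p ]
  freshman {0} pp = ⊥-elim (¬prime[0] pp)
  freshman {1} pp = ⊥-elim (¬prime[1] pp)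
  freshman {p@(suc (suc q))} pp a = ∣ᴿ-resp-≈ middle≈ (∣ᴿ-∑< (suc q) _ p∣middle)
    where
    f : ℕ → Carrier
    f k = ι (+ (p C k)) ⊗ a ^ k

    p∣middle : ∀ k → k < suc q → + p ∣ᴿ f (suc k)
    p∣middle k k<1+q = ∣⇒ι∣ᴿ (prime∣pCk pp (s≤s z≤n) (s≤s k<1+q)) (a ^ suc k)

    first : f 0 ≈ 𝟙
    first = ι1-identityˡ 𝟙

    last : f p ≈ a ^ p
    last = ≈-trans (*-congʳ (≈-trans (ι-≡ (cong +_ (Comb.nCn≡1 p))) ι-1)) (*-identityˡ (a ^ p))

    cancel : ∀ x y → (𝟙 ⊕ (x ⊕ y)) ⊖ (𝟙 ⊕ y) ≈ x
    cancel = solve 2 (λ x y → (𝟏 :+ (x :+ y)) :- (𝟏 :+ y) := x) ≈-refl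

    middle≈ : ∑[ k < suc q ] (f (suc k)) ≈ (𝟙 ⊕ a) ^ p ⊖ (𝟙 ⊕ a ^ p)
    middle≈ = ≈-sym (begin
      (𝟙 ⊕ a) ^ p ⊖ (𝟙 ⊕ a ^ p)                          ≈⟨ +-congʳ (≈-trans (binomial a p) (∑<-suc p f)) ⟩
      (f 0 ⊕ (∑[ k < suc q ] (f (suc k)) ⊕ f p)) ⊖ (𝟙 ⊕ a ^ p) ≈⟨ +-congʳ (⊕-cong first (+-congˡ last)) ⟩
      (𝟙 ⊕ (∑[ k < suc q ] (f (suc k)) ⊕ a ^ p)) ⊖ (𝟙 ⊕ a ^ p) ≈⟨ cancel _ (a ^ p) ⟩
      ∑[ k < suc q ] (f (suc k))                          ∎)

  frobenius : ∀ {p} → Prime p → ∀ a j → (𝟙 ⊕ a) ^ (p ℕ.^ j) ≈ 𝟙 ⊕ a ^ (p ℕ.^ j) [mod + p ]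
  frobenius pp a zero    = ≈⇒≈[mod] _ (≈-trans (*-identityʳ _) (+-congˡ (≈-sym (*-identityʳ a))))
  frobenius {p} pp a (suc j) =
    ≈[mod]-resp (^-^ (𝟙 ⊕ a)) (+-congˡ (^-^ a))
      (≈[mod]-trans (≈[mod]-^ p (frobenius pp a j)) (freshman pp (a ^ (p ℕ.^ j))))
    where
    ^-^ : ∀ x → (x ^ (p ℕ.^ j)) ^ p ≈ x ^ (p ℕ.^ suc j)
    ^-^ x = ≈-trans (^-assocʳ x (p ℕ.^ j) p) (^-congʳ x (ℕₚ.*-comm (p ℕ.^ j) p))

  ^-lift : ∀ {k a b} p → a ≈ b [mod k ] → a ≈ b [mod + p ] → a ^ p ≈ b ^ p [mod k ℤ.* + p ]
  ^-lift zero _ _ = ≈⇒≈[mod] _ ≈-refl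
  ^-lift {k} {a} {b} p@(suc p′) a≡b[k] a≡b[p] = ∣ᴿ-resp-≈ (factorisation p) (∣ᴿ-⊗ a≡b[k] p∣G[p])
    where
    G : ℕ → Carrier
    G zero    = 𝟘
    G (suc n) = a ^ n ⊕ b ⊗ G n

    factorisation : ∀ n → (a ⊖ b) ⊗ G n ≈ a ^ n ⊖ b ^ n
    factorisation zero    = ≈-trans (zeroʳ (a ⊖ b)) (≈-sym (-‿inverseʳ 𝟙))
    factorisation (suc n) = begin
      (a ⊖ b) ⊗ (a ^ n ⊕ b ⊗ G n)             ≈⟨ expand a b (a ^ n) (G n) ⟩
      (a ⊖ b) ⊗ a ^ n ⊕ b ⊗ ((a ⊖ b) ⊗ G n)   ≈⟨ +-congˡ (*-congˡ (factorisation n)) ⟩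
      (a ⊖ b) ⊗ a ^ n ⊕ b ⊗ (a ^ n ⊖ b ^ n)   ≈⟨ collect a b (a ^ n) (b ^ n) ⟩
      a ⊗ a ^ n ⊖ b ⊗ b ^ n                   ∎
      where
      expand : ∀ a b A G → (a ⊖ b) ⊗ (A ⊕ b ⊗ G) ≈ (a ⊖ b) ⊗ A ⊕ b ⊗ ((a ⊖ b) ⊗ G)
      expand = solve 4 (λ a b A G → (a :- b) :* (A :+ b :* G) := (a :- b) :* A :+ b :* ((a :- b) :* G)) ≈-refl
      collect : ∀ a b A B → (a ⊖ b) ⊗ A ⊕ b ⊗ (A ⊖ B) ≈ a ⊗ A ⊖ b ⊗ B
      collect = solve 4 (λ a b A B → (a :- b) :* A :+ b :* (A :- B) := a :* A :- b :* B) ≈-refl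

    G≡[1+n]b^n : ∀ n → G (suc n) ≈ ι (+ suc n) ⊗ b ^ n [mod + p ]
    G≡[1+n]b^n zero    = ≈⇒≈[mod] _ (≈-trans (+-congˡ (zeroʳ b)) (≈-trans (+-identityʳ 𝟙) (≈-sym (ι1-identityˡ 𝟙))))
    G≡[1+n]b^n (suc n) =
      ≈[mod]-resp ≈-refl (≈-trans (collect b (b ^ n) (ι (+ suc n))) (*-congʳ (≈-sym ι[2+n]≈𝟙+ι[1+n])))
        (≈[mod]-⊕ (≈[mod]-^ (suc n) a≡b[p]) (≈[mod]-⊗ˡ b (G≡[1+n]b^n n)))
      where
      ι[2+n]≈𝟙+ι[1+n] : ι (+ suc (suc n)) ≈ 𝟙 ⊕ ι (+ suc n)
      ι[2+n]≈𝟙+ι[1+n] = ≈-trans (ι-+ (+ 1) (+ suc n)) (+-congʳ ι-1)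
      collect : ∀ b B x → b ⊗ B ⊕ b ⊗ (x ⊗ B) ≈ (𝟙 ⊕ x) ⊗ (b ⊗ B)
      collect = solve 3 (λ b B x → b :* B :+ b :* (x :* B) := (𝟏 :+ x) :* (b :* B)) ≈-refl

    p∣G[p] : + p ∣ᴿ G p
    p∣G[p] = ∣ᴿ-resp-≈ (undo-shift (G p) _) (∣ᴿ-⊕ (G≡[1+n]b^n p′) (∣ᴿ-ι⊗ (+ p) (b ^ p′)))
      where
      undo-shift : ∀ x y → (x ⊖ y) ⊕ y ≈ x
      undo-shift = solve 2 (λ x y → (x :- y) :+ y := x) ≈-refl

  ^-lift-^ : ∀ {a b p} → a ≈ b [mod + p ] → ∀ j → a ^ (p ℕ.^ j) ≈ b ^ (p ℕ.^ j) [mod (+ p) ℤ.^ suc j ]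
  ^-lift-^ {a} {b} {p} a≡b zero =
    subst (a ^ 1 ≈ b ^ 1 [mod_]) (sym (ℤₚ.*-identityʳ (+ p)))
      (≈[mod]-resp (≈-sym (*-identityʳ a)) (≈-sym (*-identityʳ b)) a≡b)
  ^-lift-^ {a} {b} {p} a≡b (suc j) =
    subst (a ^ (p ℕ.^ suc j) ≈ b ^ (p ℕ.^ suc j) [mod_]) (ℤₚ.*-comm ((+ p) ℤ.^ suc j) (+ p))
      (≈[mod]-resp (^-^ a) (^-^ b) (^-lift p IH (∣ᴿ-weaken IH)))
    where
    IH = ^-lift-^ a≡b j
    ^-^ : ∀ x → (x ^ (p ℕ.^ j)) ^ p ≈ x ^ (p ℕ.^ suc j)
    ^-^ x = ≈-trans (^-assocʳ x (p ℕ.^ j) p) (^-congʳ x (ℕₚ.*-comm (p ℕ.^ j) p))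

  eigen-^ : ∀ {ε a κ} → ε ⊗ a ≈ ι κ ⊗ ε → ∀ n → ε ⊗ a ^ n ≈ ι (κ ℤ.^ n) ⊗ ε
  eigen-^ {ε} {a} {κ} εa≈κε zero = ≈-trans (*-identityʳ ε) (≈-sym (ι1-identityˡ ε))
  eigen-^ {ε} {a} {κ} εa≈κε (suc n) = begin
    ε ⊗ (a ⊗ a ^ n)            ≈⟨ *-assoc ε a (a ^ n) ⟨
    (ε ⊗ a) ⊗ a ^ n            ≈⟨ *-congʳ εa≈κε ⟩
    (ι κ ⊗ ε) ⊗ a ^ n          ≈⟨ *-assoc (ι κ) ε (a ^ n) ⟩
    ι κ ⊗ (ε ⊗ a ^ n)          ≈⟨ *-congˡ (eigen-^ εa≈κε n) ⟩
    ι κ ⊗ (ι (κ ℤ.^ n) ⊗ ε)    ≈⟨ *-assoc (ι κ) _ ε ⟨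
    (ι κ ⊗ ι (κ ℤ.^ n)) ⊗ ε    ≈⟨ *-congʳ (ι-* κ (κ ℤ.^ n)) ⟨
    ι (κ ℤ.^ suc n) ⊗ ε        ∎

  absorb-^ : ∀ {k u y} → u ⊗ y ≈ u [mod k ] → ∀ s → u ⊗ y ^ s ≈ u [mod k ]
  absorb-^ {k} {u} {y} uy≡u zero    = ≈⇒≈[mod] k (*-identityʳ u)
  absorb-^ {k} {u} {y} uy≡u (suc s) =
    ≈[mod]-trans (≈[mod]-resp (reassoc u y (y ^ s)) (*-comm (y ^ s) u) (≈[mod]-⊗ˡ (y ^ s) uy≡u)) (absorb-^ uy≡u s)
    where
    reassoc : ∀ u y z → z ⊗ (u ⊗ y) ≈ u ⊗ (y ⊗ z)
    reassoc = solve 3 (λ u y z → z :* (u :* y) := u :* (y :* z)) ≈-refl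

  𝟙^n≈𝟙 : ∀ n → 𝟙 ^ n ≈ 𝟙
  𝟙^n≈𝟙 zero    = ≈-refl
  𝟙^n≈𝟙 (suc n) = ≈-trans (*-identityˡ (𝟙 ^ n)) (𝟙^n≈𝟙 n)

  geometric-sum : ∀ y n → (𝟙 ⊖ y) ⊗ ∑[ j < n ] (y ^ j) ≈ 𝟙 ⊖ y ^ n
  geometric-sum y zero    = ≈-trans (zeroʳ (𝟙 ⊖ y)) (≈-sym (-‿inverseʳ 𝟙))
  geometric-sum y (suc n) = begin
    (𝟙 ⊖ y) ⊗ (∑[ j < n ] (y ^ j) ⊕ y ^ n)              ≈⟨ distribˡ (𝟙 ⊖ y) _ (y ^ n) ⟩
    (𝟙 ⊖ y) ⊗ ∑[ j < n ] (y ^ j) ⊕ (𝟙 ⊖ y) ⊗ y ^ n      ≈⟨ +-congʳ (geometric-sum y n) ⟩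
    (𝟙 ⊖ y ^ n) ⊕ (𝟙 ⊖ y) ⊗ y ^ n                       ≈⟨ telescope y (y ^ n) ⟩
    𝟙 ⊖ y ⊗ y ^ n                                        ∎
    where
    telescope : ∀ y Y → (𝟙 ⊖ Y) ⊕ (𝟙 ⊖ y) ⊗ Y ≈ 𝟙 ⊖ y ⊗ Y
    telescope = solve 2 (λ y Y → (𝟏 :- Y) :+ (𝟏 :- y) :* Y := 𝟏 :- y :* Y) ≈-refl

  ι⊖∑-factorises : ∀ y (f : ℕ → ℕ) n → ι (+ n) ⊖ ∑[ i < n ] (y ^ f i) ≈ (𝟙 ⊖ y) ⊗ ∑[ i < n ] (∑[ j < f i ] (y ^ j))
  ι⊖∑-factorises y f zero    = ≈-trans (+-congʳ ι-0) (≈-trans (-‿inverseʳ 𝟘) (≈-sym (zeroʳ (𝟙 ⊖ y))))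
  ι⊖∑-factorises y f (suc n) = begin
    ι (+ suc n) ⊖ (∑[ i < n ] (y ^ f i) ⊕ y ^ f n)
      ≈⟨ +-congʳ (ι-suc n) ⟩
    (ι (+ n) ⊕ 𝟙) ⊖ (∑[ i < n ] (y ^ f i) ⊕ y ^ f n)
      ≈⟨ regroup (ι (+ n)) _ (y ^ f n) ⟩
    (ι (+ n) ⊖ ∑[ i < n ] (y ^ f i)) ⊕ (𝟙 ⊖ y ^ f n)
      ≈⟨ ⊕-cong (ι⊖∑-factorises y f n) (≈-sym (geometric-sum y (f n))) ⟩
    (𝟙 ⊖ y) ⊗ ∑[ i < n ] (∑[ j < f i ] (y ^ j)) ⊕ (𝟙 ⊖ y) ⊗ ∑[ j < f n ] (y ^ j)
      ≈⟨ distribˡ (𝟙 ⊖ y) _ _ ⟨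
    (𝟙 ⊖ y) ⊗ ∑[ i < suc n ] (∑[ j < f i ] (y ^ j))
      ∎
    where
    regroup : ∀ N S Y → (N ⊕ 𝟙) ⊖ (S ⊕ Y) ≈ (N ⊖ S) ⊕ (𝟙 ⊖ Y)
    regroup = solve 3 (λ N S Y → (N :+ 𝟏) :- (S :+ Y) := (N :- S) :+ (𝟏 :- Y)) ≈-refl

  module _ {M y} (y^M≈𝟙 : y ^ M ≈ 𝟙) where

    y-absorbed-by-trace : y ⊗ ∑[ i < M ] (y ^ i) ≈ ∑[ i < M ] (y ^ i)
    y-absorbed-by-trace = begin
      y ⊗ ∑[ i < M ] (y ^ i)                           ≈⟨ split y _ ⟩
      ∑[ i < M ] (y ^ i) ⊖ (𝟙 ⊖ y) ⊗ ∑[ i < M ] (y ^ i)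
        ≈⟨ +-congˡ (⊝-cong (≈-trans (geometric-sum y M) (+-congˡ (⊝-cong y^M≈𝟙)))) ⟩
      ∑[ i < M ] (y ^ i) ⊖ (𝟙 ⊖ 𝟙)                     ≈⟨ cancel _ ⟩
      ∑[ i < M ] (y ^ i)                               ∎
      where
      split : ∀ y e → y ⊗ e ≈ e ⊖ (𝟙 ⊖ y) ⊗ e
      split = solve 2 (λ y e → y :* e := e :- (𝟏 :- y) :* e) ≈-refl
      cancel : ∀ e → e ⊖ (𝟙 ⊖ 𝟙) ≈ e
      cancel = solve 1 (λ e → e :- (𝟏 :- 𝟏) := e) ≈-refl

    ^-absorbed-by-trace : ∀ i → y ^ i ⊗ ∑[ i < M ] (y ^ i) ≈ ∑[ i < M ] (y ^ i)
    ^-absorbed-by-trace zero    = *-identityˡ _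
    ^-absorbed-by-trace (suc i) =
      ≈-trans (*-assoc y (y ^ i) _) (≈-trans (*-congˡ (^-absorbed-by-trace i)) y-absorbed-by-trace)

    trace²≈M·trace : ∑[ i < M ] (y ^ i) ⊗ ∑[ i < M ] (y ^ i) ≈ ι (+ M) ⊗ ∑[ i < M ] (y ^ i)
    trace²≈M·trace = ≈-trans (*-distribʳ-∑< M _ (y ^_)) (≈-trans (∑<-cong M ^-absorbed-by-trace) (∑<-const M _))

  module ScaledIdempotent (M : ℕ) (ε : Carrier) (ε²≈Mε : ε ⊗ ε ≈ ι (+ M) ⊗ ε) where

    u : Carrier
    u = ι (+ M) ⊖ ε

    u²≈Mu : u ⊗ u ≈ ι (+ M) ⊗ u
    u²≈Mu = begin
      (ι (+ M) ⊖ ε) ⊗ (ι (+ M) ⊖ ε)                                ≈⟨ expand (ι (+ M)) ε ⟩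
      ι (+ M) ⊗ ι (+ M) ⊖ ι (+ M) ⊗ ε ⊖ ι (+ M) ⊗ ε ⊕ ε ⊗ ε         ≈⟨ +-congˡ ε²≈Mε ⟩
      ι (+ M) ⊗ ι (+ M) ⊖ ι (+ M) ⊗ ε ⊖ ι (+ M) ⊗ ε ⊕ ι (+ M) ⊗ ε   ≈⟨ collect (ι (+ M)) ε ⟩
      ι (+ M) ⊗ (ι (+ M) ⊖ ε)                                      ∎
      where
      expand : ∀ N e → (N ⊖ e) ⊗ (N ⊖ e) ≈ N ⊗ N ⊖ N ⊗ e ⊖ N ⊗ e ⊕ e ⊗ e
      expand = solve 2 (λ N e → (N :- e) :* (N :- e) := N :* N :- N :* e :- N :* e :+ e :* e) ≈-refl
      collect : ∀ N e → N ⊗ N ⊖ N ⊗ e ⊖ N ⊗ e ⊕ N ⊗ e ≈ N ⊗ (N ⊖ e)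
      collect = solve 2 (λ N e → N :* N :- N :* e :- N :* e :+ N :* e := N :* (N :- e)) ≈-refl

    u^[1+n] : ∀ n → u ^ suc n ≈ ι ((+ M) ℤ.^ n) ⊗ u
    u^[1+n] = eigen-^ u²≈Mu

    power-congruence : ∀ {Q A B κ μ} n → Comaximal (Q ℤ.^ suc n) ((+ M) ℤ.^ n) →
      ε ⊗ A ≈ ι κ ⊗ ε → ε ⊗ B ≈ ι μ ⊗ ε → u ⊗ A ≈ u [mod Q ] →
      ι (+ M) ⊗ ((𝟙 ⊖ A) ^ suc n ⊗ B) ≈ ι (μ ℤ.* (+ 1 ℤ.- κ) ℤ.^ suc n) ⊗ ε [mod Q ℤ.^ suc n ]
    power-congruence {Q} {A} {B} {κ} {μ} n Qⁿ⁺¹⊥Mⁿ εA≈κε εB≈με uA≡u =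
      ∣ᴿ-resp-≈ split (∣ᴿ-⊗ʳ B (∣ᴿ-cancel Qⁿ⁺¹⊥Mⁿ (∣ᴿ-resp-≈ u[1-A]^[1+n] (∣ᴿ-^ (suc n) Q∣u[1-A]))))
      where
      ρ : ℤ
      ρ = (+ 1 ℤ.- κ) ℤ.^ suc n

      Q∣u[1-A] : Q ∣ᴿ u ⊗ (𝟙 ⊖ A)
      Q∣u[1-A] = ∣ᴿ-resp-≈ (flip u A) (∣ᴿ-⊝ uA≡u)
        where
        flip : ∀ u A → ⊝ (u ⊗ A ⊖ u) ≈ u ⊗ (𝟙 ⊖ A)
        flip = solve 2 (λ u A → :- (u :* A :- u) := u :* (𝟏 :- A)) ≈-refl

      u[1-A]^[1+n] : (u ⊗ (𝟙 ⊖ A)) ^ suc n ≈ ι ((+ M) ℤ.^ n) ⊗ (u ⊗ (𝟙 ⊖ A) ^ suc n)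
      u[1-A]^[1+n] = ≈-trans (^-distrib-* u (𝟙 ⊖ A) (suc n)) (≈-trans (*-congʳ (u^[1+n] n)) (*-assoc _ u _))

      ε[1-A]≈[1-κ]ε : ε ⊗ (𝟙 ⊖ A) ≈ ι (+ 1 ℤ.- κ) ⊗ ε
      ε[1-A]≈[1-κ]ε = begin
        ε ⊗ (𝟙 ⊖ A)               ≈⟨ expand ε A ⟩
        ε ⊖ ε ⊗ A                 ≈⟨ +-congˡ (⊝-cong εA≈κε) ⟩
        ε ⊖ ι κ ⊗ ε               ≈⟨ collect ε (ι κ) ⟩
        (𝟙 ⊖ ι κ) ⊗ ε             ≈⟨ *-congʳ (≈-trans (ι-+ (+ 1) (ℤ.- κ)) (⊕-cong ι-1 (ι-⊝ κ))) ⟨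
        ι (+ 1 ℤ.- κ) ⊗ ε         ∎
        where
        expand : ∀ e a → e ⊗ (𝟙 ⊖ a) ≈ e ⊖ e ⊗ a
        expand = solve 2 (λ e a → e :* (𝟏 :- a) := e :- e :* a) ≈-refl
        collect : ∀ e k → e ⊖ k ⊗ e ≈ (𝟙 ⊖ k) ⊗ e
        collect = solve 2 (λ e k → e :- k :* e := (𝟏 :- k) :* e) ≈-refl

      εZ≈ρμε : ε ⊗ ((𝟙 ⊖ A) ^ suc n ⊗ B) ≈ ι (μ ℤ.* ρ) ⊗ ε
      εZ≈ρμε = begin
        ε ⊗ ((𝟙 ⊖ A) ^ suc n ⊗ B)    ≈⟨ *-assoc ε _ B ⟨
        ε ⊗ (𝟙 ⊖ A) ^ suc n ⊗ B      ≈⟨ *-congʳ (eigen-^ ε[1-A]≈[1-κ]ε (suc n)) ⟩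
        ι ρ ⊗ ε ⊗ B                  ≈⟨ *-assoc (ι ρ) ε B ⟩
        ι ρ ⊗ (ε ⊗ B)                ≈⟨ *-congˡ εB≈με ⟩
        ι ρ ⊗ (ι μ ⊗ ε)              ≈⟨ swap (ι ρ) (ι μ) ε ⟩
        (ι μ ⊗ ι ρ) ⊗ ε              ≈⟨ *-congʳ (ι-* μ ρ) ⟨
        ι (μ ℤ.* ρ) ⊗ ε              ∎
        where
        swap : ∀ x y z → x ⊗ (y ⊗ z) ≈ (y ⊗ x) ⊗ z
        swap = solve 3 (λ x y z → x :* (y :* z) := (y :* x) :* z) ≈-refl

      split : u ⊗ (𝟙 ⊖ A) ^ suc n ⊗ B ≈ ι (+ M) ⊗ ((𝟙 ⊖ A) ^ suc n ⊗ B) ⊖ ι (μ ℤ.* ρ) ⊗ ε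
      split = ≈-trans (*-assoc u _ B)
        (≈-trans (distribʳ _ (ι (+ M)) (⊝ ε)) (+-congˡ (≈-trans (≈-sym (-‿distribˡ-* ε _)) (⊝-cong εZ≈ρμε))))
        where open import Algebra.Properties.Ring ring using (-‿distribˡ-*)

    cancel-power : ∀ {Q y} K → 0 < K → Comaximal Q (+ M) → (u ⊗ y) ^ K ≈ u ^ K [mod Q ] → u ⊗ y ^ K ≈ u [mod Q ]
    cancel-power {Q} {y} (suc K) _ Q⊥M uy^K≡u^K =
      ∣ᴿ-cancel (comaximal-sym (comaximal-^ˡ K (comaximal-sym Q⊥M))) (∣ᴿ-resp-≈ factor uy^K≡u^K)
      where
      factor : (u ⊗ y) ^ suc K ⊖ u ^ suc K ≈ ι ((+ M) ℤ.^ K) ⊗ (u ⊗ y ^ suc K ⊖ u)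
      factor = begin
        (u ⊗ y) ^ suc K ⊖ u ^ suc K                               ≈⟨ +-congʳ (^-distrib-* u y (suc K)) ⟩
        u ^ suc K ⊗ y ^ suc K ⊖ u ^ suc K
          ≈⟨ ⊕-cong (*-congʳ (u^[1+n] K)) (⊝-cong (u^[1+n] K)) ⟩
        ι ((+ M) ℤ.^ K) ⊗ u ⊗ y ^ suc K ⊖ ι ((+ M) ℤ.^ K) ⊗ u     ≈⟨ collect (ι ((+ M) ℤ.^ K)) u (y ^ suc K) ⟩
        ι ((+ M) ℤ.^ K) ⊗ (u ⊗ y ^ suc K ⊖ u)                     ∎
        where
        collect : ∀ c u Y → c ⊗ u ⊗ Y ⊖ c ⊗ u ≈ c ⊗ (u ⊗ Y ⊖ u)
        collect = solve 3 (λ c u Y → c :* u :* Y :- c :* u := c :* (u :* Y :- u)) ≈-refl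

    module _ {x h : Carrier} (u≈h[1+x] : u ≈ h ⊗ (𝟙 ⊕ x)) where

      prime-power-congruence : ∀ {p} a β → Prime p → x ^ (p ℕ.^ β) ≈ x → Comaximal (+ p) (+ M) →
        u ⊗ (𝟙 ⊕ x) ^ (p ℕ.^ a ℕ.* (p ℕ.^ β ∸ 1)) ≈ u [mod (+ p) ℤ.^ suc a ]
      prime-power-congruence {p} a β pp x^pᵝ≈x p⊥M =
        ≈[mod]-resp (*-congˡ Y^pᵃ≈) ≈-refl
          (cancel-power (p ℕ.^ a) (ℕₚ.m^n>0 p a) (comaximal-^ˡ (suc a) p⊥M) (^-lift-^ uY≡u a))
        where
        instance _ = prime⇒nonZero pp

        E : ℕ
        E = p ℕ.^ β ∸ 1

        Y : Carrier
        Y = (𝟙 ⊕ x) ^ E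

        pᵝ≡1+E : p ℕ.^ β ≡ suc E
        pᵝ≡1+E = sym (trans (ℕₚ.+-comm 1 E) (ℕₚ.m∸n+n≡m (ℕₚ.m^n>0 p β)))

        [1+x]Y≡1+x : (𝟙 ⊕ x) ⊗ Y ≈ 𝟙 ⊕ x [mod + p ]
        [1+x]Y≡1+x = ≈[mod]-resp (^-congʳ (𝟙 ⊕ x) pᵝ≡1+E) (+-congˡ x^pᵝ≈x) (frobenius pp x β)

        uY≡u : u ⊗ Y ≈ u [mod + p ]
        uY≡u = ≈[mod]-resp (≈-trans (≈-sym (*-assoc h _ Y)) (*-congʳ (≈-sym u≈h[1+x]))) (≈-sym u≈h[1+x])
                 (≈[mod]-⊗ˡ h [1+x]Y≡1+x)

        Y^pᵃ≈ : Y ^ (p ℕ.^ a) ≈ (𝟙 ⊕ x) ^ (p ℕ.^ a ℕ.* E)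
        Y^pᵃ≈ = ≈-trans (^-assocʳ (𝟙 ⊕ x) E (p ℕ.^ a)) (^-congʳ (𝟙 ⊕ x) (ℕₚ.*-comm E (p ℕ.^ a)))

      module _ (x^M≈𝟙 : x ^ M ≈ 𝟙) where

        x^[1+tM]≈x : ∀ t → x ^ suc (t ℕ.* M) ≈ x
        x^[1+tM]≈x t = begin
          x ⊗ x ^ (t ℕ.* M)   ≈⟨ *-congˡ (^-congʳ x (ℕₚ.*-comm t M)) ⟩
          x ⊗ x ^ (M ℕ.* t)   ≈⟨ *-congˡ (^-assocʳ x M t) ⟨
          x ⊗ (x ^ M) ^ t     ≈⟨ *-congˡ (≈-trans (^-congˡ t x^M≈𝟙) (𝟙^n≈𝟙 t)) ⟩
          x ⊗ 𝟙               ≈⟨ *-identityʳ x ⟩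
          x                   ∎

        factor-congruence : ∀ {q T p α β} → Coprime q M → PrimePowerFactor M (p , α , β) → p ℕ.^ α ∣ q →
          factorν (p , α , β) ∣ T → u ⊗ (𝟙 ⊕ x) ^ T ≈ u [mod + (p ℕ.^ α) ]
        factor-congruence {α = zero} _ (_ , () , _)
        factor-congruence {q} {T} {p} {suc a} {β} q⊥M (pp , _ , order) pᵅ∣q (ℕ∣.divides s T≡sν) =
          subst (u ⊗ (𝟙 ⊕ x) ^ T ≈ u [mod_]) (sym (pos-^ p (suc a)))
            (≈[mod]-resp (*-congˡ Yˢ≈) ≈-refl (absorb-^ (prime-power-congruence a β pp x^pᵝ≈x p⊥M) s))
          where
          instance _ = prime⇒nonZero pp

          p⊥M : Comaximal (+ p) (+ M)
          p⊥M = coprime⇒comaximal (λ (d∣p , d∣M) → q⊥M (ℕ∣.∣-trans d∣p (ℕ∣.∣-trans (ℕ∣.m∣m*n (p ℕ.^ a)) pᵅ∣q) , d∣M))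

          x^pᵝ≈x : x ^ (p ℕ.^ β) ≈ x
          x^pᵝ≈x with (t , pᵝ≡1+tM) ← ≡1[mod]⇒≡1+multiple (ℕₚ.m^n>0 p β) (proj₁ (proj₂ order)) =
            ≈-trans (^-congʳ x pᵝ≡1+tM) (x^[1+tM]≈x t)

          Yˢ≈ : ((𝟙 ⊕ x) ^ factorν (p , suc a , β)) ^ s ≈ (𝟙 ⊕ x) ^ T
          Yˢ≈ = ≈-trans (^-assocʳ _ (factorν (p , suc a , β)) s) (^-congʳ _ (trans (ℕₚ.*-comm _ s) (sym T≡sν)))

        factors-congruence : ∀ {q T} L → Coprime q M → All (PrimePowerFactor M) L → AllPairs DistinctPrimes L →
          ∏ L ∣ q → lcmν L ∣ T → u ⊗ (𝟙 ⊕ x) ^ T ≈ u [mod + ∏ L ]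
        factors-congruence [] _ _ _ _ _ = _ , ≈-sym (ι1-identityˡ _)
        factors-congruence {q} {T} ((p , α , β) ∷ L) q⊥M (valid ∷ valids) (distinct ∷ distincts) ∏∣q lcm∣T =
          subst (u ⊗ (𝟙 ⊕ x) ^ T ≈ u [mod_]) (sym (ℤₚ.pos-* (p ℕ.^ α) (∏ L)))
            (∣ᴿ-crt pᵅ⊥∏
              (factor-congruence q⊥M valid (ℕ∣.∣-trans (ℕ∣.m∣m*n (∏ L)) ∏∣q) (ℕ∣.∣-trans (m∣lcm[m,n] _ _) lcm∣T))
              (factors-congruence L q⊥M valids distincts (ℕ∣.∣-trans (ℕ∣.n∣m*n (p ℕ.^ α)) ∏∣q)
                 (ℕ∣.∣-trans (n∣lcm[m,n] (factorν (p , α , β)) _) lcm∣T)))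
          where
          pᵅ⊥∏ : Comaximal (+ (p ℕ.^ α)) (+ ∏ L)
          pᵅ⊥∏ = subst (λ z → Comaximal z (+ ∏ L)) (sym (pos-^ p α))
                   (comaximal-^ˡ α (comaximal-∏ {M} {p} {α} {β} (proj₁ valid) valids distinct))

        ν-congruence : ∀ {q T} → Coprime q M → (d : NuData M q) → ν d ∣ T → u ⊗ (𝟙 ⊕ x) ^ T ≈ u [mod + q ]
        ν-congruence q⊥M d ν∣T =
          subst (λ n → _ ≈ _ [mod + n ]) (∏-factors d)
            (factors-congruence (NuData.factors d) q⊥M (factors-valid d) (factors-distinct d)
               (ℕ∣.∣-reflexive (∏-factors d)) (subst (_∣ _) (ν≡lcmν d) ν∣T))

-- Periodic sums of binomial coefficients

isYes-true : ∀ {A : Set} (a? : Dec A) → A → ⌊ a? ⌋ ≡ true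
isYes-true a? a = trans (isYes≗does a?) (dec-true a? a)

isYes-false : ∀ {A : Set} (a? : Dec A) → ¬ A → ⌊ a? ⌋ ≡ false
isYes-false a? ¬a = trans (isYes≗does a?) (dec-false a? ¬a)

isYes-cong : ∀ {A B : Set} (a? : Dec A) (b? : Dec B) → (A → B) → (B → A) → ⌊ a? ⌋ ≡ ⌊ b? ⌋
isYes-cong (yes _) (yes _) _   _   = refl
isYes-cong (no _)  (no _)  _   _   = refl
isYes-cong (yes a) (no ¬b) a→b _   = ⊥-elim (¬b (a→b a))
isYes-cong (no ¬a) (yes b) _   b→a = ⊥-elim (¬a (b→a b))

Σ≤-cong : ∀ n {f g} → (∀ k → f k ≡ g k) → Σ≤ n f ≡ Σ≤ n g
Σ≤-cong zero    f≡g = f≡g zero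
Σ≤-cong (suc n) f≡g = cong₂ ℤ._+_ (Σ≤-cong n f≡g) (f≡g (suc n))

Σ≤-suc : ∀ n f → Σ≤ (suc n) f ≡ f 0 ℤ.+ Σ≤ n (λ k → f (suc k))
Σ≤-suc zero    f = refl
Σ≤-suc (suc n) f = trans (cong (ℤ._+ f (suc (suc n))) (Σ≤-suc n f)) (ℤₚ.+-assoc (f 0) _ _)

Σ≤-+ : ∀ n f g → Σ≤ n (λ k → f k ℤ.+ g k) ≡ Σ≤ n f ℤ.+ Σ≤ n g
Σ≤-+ zero    f g = refl
Σ≤-+ (suc n) f g =
  trans (cong (ℤ._+ (f (suc n) ℤ.+ g (suc n))) (Σ≤-+ n f g)) (interchange (Σ≤ n f) (Σ≤ n g) (f (suc n)) (g (suc n)))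
  where
  interchange : ∀ a b c d → (a ℤ.+ b) ℤ.+ (c ℤ.+ d) ≡ (a ℤ.+ c) ℤ.+ (b ℤ.+ d)
  interchange = solve-∀

Σ≤-concentrated : ∀ n f → (∀ k → 0 < k → k ≤ n → f k ≡ + 0) → Σ≤ n f ≡ f 0
Σ≤-concentrated zero    f _      = refl
Σ≤-concentrated (suc n) f f[k]≡0 =
  trans (cong₂ ℤ._+_ (Σ≤-concentrated n f (λ k 0<k k≤n → f[k]≡0 k 0<k (ℕₚ.m≤n⇒m≤1+n k≤n)))
                     (f[k]≡0 (suc n) (s≤s z≤n) ℕₚ.≤-refl))
        (ℤₚ.+-identityʳ (f 0))

module _ (m : ℕ) where

  private
    term : ℕ → ℤ → ℕ → ℤ
    term N r k = if ⌊ (+ m) ∣?ℤ ((+ k) ℤ.- r) ⌋ then binomℤ N k else + 0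

    if-+ : ∀ b x y → (if b then x ℤ.+ y else + 0) ≡ (if b then x else + 0) ℤ.+ (if b then y else + 0)
    if-+ true  x y = refl
    if-+ false x y = refl

    if-0 : ∀ b → (if b then + 0 else + 0) ≡ + 0
    if-0 true  = refl
    if-0 false = refl

    term-top : ∀ N r → term N r (suc N) ≡ + 0
    term-top N r =
      trans (cong (λ c → if ⌊ (+ m) ∣?ℤ ((+ suc N) ℤ.- r) ⌋ then + c else + 0) (Comb.k>n⇒nCk≡0 (ℕₚ.n<1+n N))) (if-0 _)

    term-pascal : ∀ N r k → term (suc N) r (suc k) ≡ term N r (suc k) ℤ.+ term N (r ℤ.- + 1) k
    term-pascal N r k = begin
      term (suc N) r (suc k)
        ≡⟨ cong (λ c → if ⌊ (+ m) ∣?ℤ ((+ suc k) ℤ.- r) ⌋ then c else + 0) pascal ⟩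
      (if ⌊ (+ m) ∣?ℤ ((+ suc k) ℤ.- r) ⌋ then binomℤ N (suc k) ℤ.+ binomℤ N k else + 0)
        ≡⟨ if-+ _ (binomℤ N (suc k)) (binomℤ N k) ⟩
      term N r (suc k) ℤ.+ (if ⌊ (+ m) ∣?ℤ ((+ suc k) ℤ.- r) ⌋ then binomℤ N k else + 0)
        ≡⟨ cong (λ z → term N r (suc k) ℤ.+ (if ⌊ (+ m) ∣?ℤ z ⌋ then binomℤ N k else + 0)) (shift-index (+ k) r) ⟩
      term N r (suc k) ℤ.+ term N (r ℤ.- + 1) k
        ∎
      where
      open ≡-Reasoning
      pascal : binomℤ (suc N) (suc k) ≡ binomℤ N (suc k) ℤ.+ binomℤ N k
      pascal = trans (cong +_ (trans (sym (Comb.nCk+nC[k+1]≡[n+1]C[k+1] N k)) (ℕₚ.+-comm (N C k) _)))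
                     (ℤₚ.pos-+ _ (N C k))
      shift-index : ∀ k r → (+ 1 ℤ.+ k) ℤ.- r ≡ k ℤ.- (r ℤ.- + 1)
      shift-index = solve-∀

  binomSumMod-suc : ∀ N r → binomSumMod m (suc N) r ≡ binomSumMod m N r ℤ.+ binomSumMod m N (r ℤ.- + 1)
  binomSumMod-suc N r = begin
    Σ≤ (suc N) (term (suc N) r)
      ≡⟨ Σ≤-suc N (term (suc N) r) ⟩
    term N r 0 ℤ.+ Σ≤ N (λ k → term (suc N) r (suc k))
      ≡⟨ cong (λ z → term N r 0 ℤ.+ z) (trans (Σ≤-cong N (term-pascal N r)) (Σ≤-+ N _ _)) ⟩
    term N r 0 ℤ.+ (Σ≤ N (λ k → term N r (suc k)) ℤ.+ Σ≤ N (term N (r ℤ.- + 1)))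
      ≡⟨ ℤₚ.+-assoc (term N r 0) _ _ ⟨
    term N r 0 ℤ.+ Σ≤ N (λ k → term N r (suc k)) ℤ.+ Σ≤ N (term N (r ℤ.- + 1))
      ≡⟨ cong (λ z → z ℤ.+ Σ≤ N (term N (r ℤ.- + 1))) (Σ≤-suc N (term N r)) ⟨
    Σ≤ N (term N r) ℤ.+ term N r (suc N) ℤ.+ Σ≤ N (term N (r ℤ.- + 1))
      ≡⟨ cong (λ z → Σ≤ N (term N r) ℤ.+ z ℤ.+ Σ≤ N (term N (r ℤ.- + 1))) (term-top N r) ⟩
    Σ≤ N (term N r) ℤ.+ + 0 ℤ.+ Σ≤ N (term N (r ℤ.- + 1))
      ≡⟨ cong (ℤ._+ Σ≤ N (term N (r ℤ.- + 1))) (ℤₚ.+-identityʳ (Σ≤ N (term N r))) ⟩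
    Σ≤ N (term N r) ℤ.+ Σ≤ N (term N (r ℤ.- + 1))
      ∎
    where open ≡-Reasoning

recurrence-unique : ∀ {σ} → σ ℤ.* σ ≡ + 1 → (g g′ : ℤ → ℤ) →
  (∀ r → g (r ℤ.- + 1) ≡ σ ℤ.* g r) → (∀ r → g′ (r ℤ.- + 1) ≡ σ ℤ.* g′ r) → g (+ 0) ≡ g′ (+ 0) →
  ∀ r → g r ≡ g′ r
recurrence-unique {σ} σ²≡1 g g′ g-rec g′-rec g₀≡g′₀ = agree
  where
  step-up : ∀ f → (∀ r → f (r ℤ.- + 1) ≡ σ ℤ.* f r) → ∀ n → f (+ suc n) ≡ σ ℤ.* f (+ n)
  step-up f f-rec n = begin
    f (+ suc n)                  ≡⟨ ℤₚ.*-identityˡ (f (+ suc n)) ⟨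
    + 1 ℤ.* f (+ suc n)          ≡⟨ cong (ℤ._* f (+ suc n)) σ²≡1 ⟨
    σ ℤ.* σ ℤ.* f (+ suc n)      ≡⟨ ℤₚ.*-assoc σ σ (f (+ suc n)) ⟩
    σ ℤ.* (σ ℤ.* f (+ suc n))    ≡⟨ cong (σ ℤ.*_) (f-rec (+ suc n)) ⟨
    σ ℤ.* f (+ n)                ∎
    where open ≡-Reasoning

  step-down : ∀ f → (∀ r → f (r ℤ.- + 1) ≡ σ ℤ.* f r) → ∀ n → f (- + suc n) ≡ σ ℤ.* f (- + n)
  step-down f f-rec n = trans (cong f (sym (negate-suc (+ n)))) (f-rec (- + n))
    where
    negate-suc : ∀ x → - x ℤ.- + 1 ≡ - (+ 1 ℤ.+ x)
    negate-suc = solve-∀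

  nonneg : ∀ n → g (+ n) ≡ g′ (+ n)
  nonneg zero    = g₀≡g′₀
  nonneg (suc n) = trans (step-up g g-rec n) (trans (cong (σ ℤ.*_) (nonneg n)) (sym (step-up g′ g′-rec n)))

  nonpos : ∀ n → g (- + n) ≡ g′ (- + n)
  nonpos zero    = g₀≡g′₀
  nonpos (suc n) = trans (step-down g g-rec n) (trans (cong (σ ℤ.*_) (nonpos n)) (sym (step-down g′ g′-rec n)))

  agree : ∀ r → g r ≡ g′ r
  agree (+ n)      = nonneg n
  agree ℤ.-[1+ n ] = nonpos (suc n)

minusOnePow-recurrence : ∀ r → minusOnePow (r ℤ.- + 1) ≡ - (+ 1) ℤ.* minusOnePow r
minusOnePow-recurrence r with (+ 2) ∣?ℤ r
... | yes 2∣r = cong (λ b → if b then + 1 else - (+ 1)) (isYes-false ((+ 2) ∣?ℤ _) 2∤r-1)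
  where
  2∤r-1 : ¬ (+ 2) ℤ∣.∣ (r ℤ.- + 1)
  2∤r-1 2∣r-1 =
    ℕₚ.<⇒≱ (s≤s (s≤s z≤n)) (ℕ∣.∣⇒≤ (ℤ∣.∣⇒∣ᵤ (subst ((+ 2) ℤ∣.∣_) (difference r) (ℤ∣.∣m∣n⇒∣m-n 2∣r 2∣r-1))))
    where
    difference : ∀ r → r ℤ.- (r ℤ.- + 1) ≡ + 1
    difference = solve-∀
... | no 2∤r = cong (λ b → if b then + 1 else - (+ 1)) (isYes-true ((+ 2) ∣?ℤ _) 2∣r-1)
  where
  2∣r-1 : (+ 2) ℤ∣.∣ (r ℤ.- + 1)
  2∣r-1 with r ℤ/.% + 2 | ℤ/.a≡a%n+[a/n]*n r (+ 2) | ℤ/.n%d<d r (+ 2)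
  ... | 0           | r≡2q   | _ = ⊥-elim (2∤r (ℤ∣.divides (r ℤ/./ + 2) (trans r≡2q (ℤₚ.+-identityˡ _))))
  ... | 1           | r≡1+2q | _ =
    ℤ∣.divides (r ℤ/./ + 2) (trans (cong (ℤ._- + 1) r≡1+2q) (cancel (r ℤ/./ + 2 ℤ.* + 2)))
    where
    cancel : ∀ x → + 1 ℤ.+ x ℤ.- + 1 ≡ x
    cancel = solve-∀
  ... | suc (suc _) | _      | s≤s (s≤s ())

alternatingSum : ℕ → ℕ → ℕ → ℕ → ℤ → ℤ
alternatingSum m T l n r = Σ≤ n (λ k → ((- (+ 1)) ℤ.^ k) ℤ.* binomℤ n k ℤ.* binomSumMod m (k ℕ.* T ℕ.+ l) r)

parity-split : ∀ m → (∃ λ c → m ≡ c ℕ.+ c) ⊎ (∃ λ c → m ≡ suc (c ℕ.+ c))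
parity-split zero    = inj₁ (0 , refl)
parity-split (suc m) with parity-split m
... | inj₁ (c , m≡2c)   = inj₂ (c , cong suc m≡2c)
... | inj₂ (c , m≡1+2c) = inj₁ (suc c , cong suc (trans m≡1+2c (sym (ℕₚ.+-suc c c))))

c+c≡c*2 : ∀ c → c ℕ.+ c ≡ c ℕ.* 2
c+c≡c*2 = solve-∀ℕ

odd⇒≡1+2c : ∀ {m} → ¬ (2 ∣ m) → ∃ λ c → m ≡ suc (c ℕ.+ c)
odd⇒≡1+2c {m} 2∤m with parity-split m
... | inj₁ (c , m≡2c) = ⊥-elim (2∤m (ℕ∣.divides c (trans m≡2c (c+c≡c*2 c))))
... | inj₂ m-odd      = m-odd

even⇒≡2c : ∀ {m} → 2 ∣ m → ∃ λ c → m ≡ c ℕ.+ c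
even⇒≡2c (ℕ∣.divides c m≡c*2) = c , trans m≡c*2 (sym (c+c≡c*2 c))

0^l≡δ0 : ∀ l → (+ 0) ℤ.^ l ≡ δ0 l
0^l≡δ0 zero    = refl
0^l≡δ0 (suc l) = refl

-- Integer polynomials in the shift X; identifying operators that act alike on m-periodic sequences
-- turns them into the group ring ℤ[X]/(X^m − 1).
module ShiftOperators (m : ℕ) where

  Sequence : Set
  Sequence = ℤ → ℤ

  Periodic : Sequence → Set
  Periodic v = ∀ r → v (r ℤ.+ + m) ≡ v r

  data Op : Set where
    scale   : ℤ → Op
    shift   : Op
    plus    : Op → Op → Op
    compose : Op → Op → Op
    negate  : Op → Op

  act : Op → Sequence → Sequence
  act (scale c)     v r = c ℤ.* v r
  act shift         v r = v (r ℤ.- + 1)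
  act (plus a b)    v r = act a v r ℤ.+ act b v r
  act (compose a b) v r = act a (act b v) r
  act (negate a)    v r = ℤ.- act a v r

  infix 4 _≃_
  record _≃_ (a b : Op) : Set where
    constructor mk≃
    field act-≡ : ∀ v → Periodic v → ∀ r → act a v r ≡ act b v r
  open _≃_ public

  act-cong : ∀ a {v w} → (∀ r → v r ≡ w r) → ∀ r → act a v r ≡ act a w r
  act-cong (scale c)     v≡w r = cong (c ℤ.*_) (v≡w r)
  act-cong shift         v≡w r = v≡w (r ℤ.- + 1)
  act-cong (plus a b)    v≡w r = cong₂ ℤ._+_ (act-cong a v≡w r) (act-cong b v≡w r)
  act-cong (compose a b) v≡w r = act-cong a (act-cong b v≡w) r
  act-cong (negate a)    v≡w r = cong ℤ.-_ (act-cong a v≡w r)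

  act-periodic : ∀ a {v} → Periodic v → Periodic (act a v)
  act-periodic (scale c)     per r = cong (c ℤ.*_) (per r)
  act-periodic shift {v}     per r = trans (cong v (shift-comm r (+ m))) (per (r ℤ.- + 1))
    where
    shift-comm : ∀ r k → r ℤ.+ k ℤ.- + 1 ≡ r ℤ.- + 1 ℤ.+ k
    shift-comm = solve-∀
  act-periodic (plus a b)    per r = cong₂ ℤ._+_ (act-periodic a per r) (act-periodic b per r)
  act-periodic (compose a b) per r = act-periodic a (act-periodic b per) r
  act-periodic (negate a)    per r = cong ℤ.-_ (act-periodic a per r)

  act-+ : ∀ a v w r → act a (λ s → v s ℤ.+ w s) r ≡ act a v r ℤ.+ act a w r
  act-+ (scale c)     v w r = ℤₚ.*-distribˡ-+ c (v r) (w r)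
  act-+ shift         v w r = refl
  act-+ (plus a b)    v w r =
    trans (cong₂ ℤ._+_ (act-+ a v w r) (act-+ b v w r)) (interchange (act a v r) (act a w r) (act b v r) (act b w r))
    where
    interchange : ∀ x y z t → (x ℤ.+ y) ℤ.+ (z ℤ.+ t) ≡ (x ℤ.+ z) ℤ.+ (y ℤ.+ t)
    interchange = solve-∀
  act-+ (compose a b) v w r = trans (act-cong a (act-+ b v w) r) (act-+ a _ _ r)
  act-+ (negate a)    v w r = trans (cong ℤ.-_ (act-+ a v w r)) (ℤₚ.neg-distrib-+ (act a v r) (act a w r))

  act-* : ∀ a c v r → act a (λ s → c ℤ.* v s) r ≡ c ℤ.* act a v r
  act-* (scale d)     c v r = swap d c (v r)
    where
    swap : ∀ d c x → d ℤ.* (c ℤ.* x) ≡ c ℤ.* (d ℤ.* x)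
    swap = solve-∀
  act-* shift         c v r = refl
  act-* (plus a b)    c v r = trans (cong₂ ℤ._+_ (act-* a c v r) (act-* b c v r)) (sym (ℤₚ.*-distribˡ-+ c _ _))
  act-* (compose a b) c v r = trans (act-cong a (act-* b c v) r) (act-* a c _ r)
  act-* (negate a)    c v r = trans (cong ℤ.-_ (act-* a c v r)) (ℤₚ.neg-distribʳ-* c _)

  act-negate : ∀ a v r → act a (λ s → ℤ.- v s) r ≡ ℤ.- act a v r
  act-negate a v r =
    trans (act-cong a (λ s → sym (ℤₚ.-1*i≡-i (v s))) r) (trans (act-* a (- + 1) v r) (ℤₚ.-1*i≡-i _))

  act-shift : ∀ a v r → act a (λ s → v (s ℤ.- + 1)) r ≡ act a v (r ℤ.- + 1)
  act-shift (scale c)     v r = refl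
  act-shift shift         v r = refl
  act-shift (plus a b)    v r = cong₂ ℤ._+_ (act-shift a v r) (act-shift b v r)
  act-shift (compose a b) v r = trans (act-cong a (act-shift b v) r) (act-shift a _ r)
  act-shift (negate a)    v r = cong ℤ.-_ (act-shift a v r)

  act-comm : ∀ a b v r → act a (act b v) r ≡ act b (act a v) r
  act-comm (scale c)       b v r = sym (act-* b c v r)
  act-comm shift           b v r = sym (act-shift b v r)
  act-comm (plus a₁ a₂)    b v r = trans (cong₂ ℤ._+_ (act-comm a₁ b v r) (act-comm a₂ b v r)) (sym (act-+ b _ _ r))
  act-comm (compose a₁ a₂) b v r = trans (act-cong a₁ (act-comm a₂ b v) r) (act-comm a₁ b _ r)
  act-comm (negate a)      b v r = trans (cong ℤ.-_ (act-comm a b v r)) (sym (act-negate b _ r))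

  Op-isCommutativeRing : IsCommutativeRing _≃_ plus compose negate (scale (+ 0)) (scale (+ 1))
  Op-isCommutativeRing = record
    { isRing = record
      { +-isAbelianGroup = record
        { isGroup = record
          { isMonoid = record
            { isSemigroup = record
              { isMagma = record
                { isEquivalence = record
                  { refl  = mk≃ λ _ _ _ → refl
                  ; sym   = λ a≃b → mk≃ λ v per r → sym (act-≡ a≃b v per r)
                  ; trans = λ a≃b b≃c → mk≃ λ v per r → trans (act-≡ a≃b v per r) (act-≡ b≃c v per r) }
                ; ∙-cong = λ a≃b c≃d → mk≃ λ v per r → cong₂ ℤ._+_ (act-≡ a≃b v per r) (act-≡ c≃d v per r) }
              ; assoc = λ a b c → mk≃ λ v _ r → ℤₚ.+-assoc (act a v r) (act b v r) (act c v r) }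
            ; identity = (λ a → mk≃ λ v _ r → trans (cong (ℤ._+ act a v r) (ℤₚ.*-zeroˡ (v r))) (ℤₚ.+-identityˡ _))
                       , (λ a → mk≃ λ v _ r → ℤₚ.+-identityʳ (act a v r)) }
          ; inverse = (λ a → mk≃ λ v _ r → trans (ℤₚ.+-inverseˡ (act a v r)) (sym (ℤₚ.*-zeroˡ (v r))))
                    , (λ a → mk≃ λ v _ r → trans (ℤₚ.+-inverseʳ (act a v r)) (sym (ℤₚ.*-zeroˡ (v r))))
          ; ⁻¹-cong = λ a≃b → mk≃ λ v per r → cong ℤ.-_ (act-≡ a≃b v per r) }
        ; comm = λ a b → mk≃ λ v _ r → ℤₚ.+-comm (act a v r) (act b v r) }
      ; *-cong = λ {a} {a′} {b} {b′} a≃a′ b≃b′ → mk≃ λ v per r →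
          trans (act-cong a (act-≡ b≃b′ v per) r) (act-≡ a≃a′ _ (act-periodic b′ per) r)
      ; *-assoc = λ _ _ _ → mk≃ λ _ _ _ → refl
      ; *-identity = (λ _ → mk≃ λ _ _ _ → ℤₚ.*-identityˡ _)
                   , (λ a → mk≃ λ v _ r → act-cong a (λ s → ℤₚ.*-identityˡ (v s)) r)
      ; distrib = (λ a _ _ → mk≃ λ _ _ r → act-+ a _ _ r) , (λ _ _ _ → mk≃ λ _ _ _ → refl) }
    ; *-comm = λ a b → mk≃ λ v _ r → act-comm a b v r }

  Op-commutativeRing : CommutativeRing 0ℓ 0ℓ
  Op-commutativeRing = record { isCommutativeRing = Op-isCommutativeRing }

  scale-isRingHomomorphism : IsRingHomomorphism ℤ.+-*-rawRing (CommutativeRing.rawRing Op-commutativeRing) scale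
  scale-isRingHomomorphism = record
    { isSemiringHomomorphism = record
      { isNearSemiringHomomorphism = record
        { +-isMonoidHomomorphism = record
          { isMagmaHomomorphism = record
            { isRelHomomorphism = record { cong = λ { refl → mk≃ λ _ _ _ → refl } }
            ; homo = λ a b → mk≃ λ v _ _ → ℤₚ.*-distribʳ-+ (v _) a b }
          ; ε-homo = mk≃ λ _ _ _ → refl }
        ; *-homo = λ a b → mk≃ λ v _ _ → ℤₚ.*-assoc a b (v _) }
      ; 1#-homo = mk≃ λ _ _ _ → refl }
    ; -‿homo = λ a → mk≃ λ v _ _ → sym (ℤₚ.neg-distribˡ-* a (v _)) }

  open IntegerAlgebra Op-commutativeRing scale scale-isRingHomomorphism public

  X : Carrier
  X = shift

  act-X^ : ∀ n v r → act (X ^ n) v r ≡ v (r ℤ.- + n)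
  act-X^ zero    v r = trans (ℤₚ.*-identityˡ (v r)) (cong v (sym (ℤₚ.+-identityʳ r)))
  act-X^ (suc n) v r = trans (act-X^ n v (r ℤ.- + 1)) (cong v (reassoc r (+ n)))
    where
    reassoc : ∀ r n → r ℤ.- + 1 ℤ.- n ≡ r ℤ.- (+ 1 ℤ.+ n)
    reassoc = solve-∀

  X^m≈𝟙 : X ^ m ≈ 𝟙
  X^m≈𝟙 = mk≃ λ v per r → begin
    act (X ^ m) v r            ≡⟨ act-X^ m v r ⟩
    v (r ℤ.- + m)              ≡⟨ per (r ℤ.- + m) ⟨
    v (r ℤ.- + m ℤ.+ + m)      ≡⟨ cong v (cancel r (+ m)) ⟩
    v r                        ≡⟨ ℤₚ.*-identityˡ (v r) ⟨
    + 1 ℤ.* v r                ∎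
    where
    open ≡-Reasoning
    cancel : ∀ r k → r ℤ.- k ℤ.+ k ≡ r
    cancel = solve-∀

  X^[m*j]≈𝟙 : ∀ j → X ^ (m ℕ.* j) ≈ 𝟙
  X^[m*j]≈𝟙 j = ≈-trans (≈-sym (^-assocʳ X m j)) (≈-trans (^-congˡ j X^m≈𝟙) (𝟙^n≈𝟙 j))

  act-∑< : ∀ n f v r → act (∑< (suc n) f) v r ≡ Σ≤ n (λ k → act (f k) v r)
  act-∑< zero    f v r = ℤₚ.+-identityˡ (act (f 0) v r)
  act-∑< (suc n) f v r = cong (ℤ._+ act (f (suc n)) v r) (act-∑< n f v r)

  δ : Sequence
  δ = binomSumMod m 0

  δ-periodic : Periodic δ
  δ-periodic r = cong (λ b → if b then + 1 else + 0) (isYes-cong (_ ∣?ℤ _) (_ ∣?ℤ _)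
    (λ m∣ → ℤ∣.∣m+n∣n⇒∣m (subst (_ ℤ∣.∣_) (shift-out r (+ m)) m∣) (ℤ∣.∣m⇒∣-m ℤ∣.∣-refl))
    (λ m∣ → subst (_ ℤ∣.∣_) (sym (shift-out r (+ m))) (ℤ∣.∣m∣n⇒∣m+n m∣ (ℤ∣.∣m⇒∣-m ℤ∣.∣-refl))))
    where
    shift-out : ∀ r k → + 0 ℤ.- (r ℤ.+ k) ≡ (+ 0 ℤ.- r) ℤ.+ - k
    shift-out = solve-∀

  δ-origin : δ (+ 0) ≡ + 1
  δ-origin = cong (λ b → if b then + 1 else + 0) (isYes-true ((+ m) ∣?ℤ (+ 0)) (ℤ∣.divides (+ 0) refl))

  δ-vanishes : ∀ i → 0 < i → i < m → δ (+ 0 ℤ.- + i) ≡ + 0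
  δ-vanishes i 0<i i<m = cong (λ b → if b then + 1 else + 0) (isYes-false ((+ m) ∣?ℤ _) m∤i)
    where
    instance _ = ℕ.>-nonZero 0<i
    double-negation : ∀ x → + 0 ℤ.- (+ 0 ℤ.- x) ≡ x
    double-negation = solve-∀
    m∤i : ¬ (+ m) ℤ∣.∣ (+ 0 ℤ.- (+ 0 ℤ.- + i))
    m∤i m∣i = ℕₚ.<⇒≱ i<m (ℕ∣.∣⇒≤ (ℤ∣.∣⇒∣ᵤ (subst ((+ m) ℤ∣.∣_) (double-negation (+ i)) m∣i)))

  act-[1+X]^ : ∀ N r → act ((𝟙 ⊕ X) ^ N) δ r ≡ binomSumMod m N r
  act-[1+X]^ zero    r = ℤₚ.*-identityˡ (δ r)
  act-[1+X]^ (suc N) r =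
    trans (cong₂ ℤ._+_ (trans (ℤₚ.*-identityˡ _) (act-[1+X]^ N r)) (act-[1+X]^ N (r ℤ.- + 1)))
          (sym (binomSumMod-suc m N r))

  act-alternating-sum : ∀ n T l r → act ((𝟙 ⊖ (𝟙 ⊕ X) ^ T) ^ n ⊗ (𝟙 ⊕ X) ^ l) δ r ≡ alternatingSum m T l n r
  act-alternating-sum n T l r = begin
    act ((𝟙 ⊖ A) ^ n ⊗ (𝟙 ⊕ X) ^ l) δ r
      ≡⟨ act-≡ expansion δ δ-periodic r ⟩
    act (∑[ k < suc n ] (scale (coefficient k) ⊗ (𝟙 ⊕ X) ^ (k ℕ.* T ℕ.+ l))) δ r
      ≡⟨ act-∑< n _ δ r ⟩
    Σ≤ n (λ k → coefficient k ℤ.* act ((𝟙 ⊕ X) ^ (k ℕ.* T ℕ.+ l)) δ r)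
      ≡⟨ Σ≤-cong n (λ k → cong (coefficient k ℤ.*_) (act-[1+X]^ (k ℕ.* T ℕ.+ l) r)) ⟩
    Σ≤ n (λ k → coefficient k ℤ.* binomSumMod m (k ℕ.* T ℕ.+ l) r)
      ∎
    where
    open ≡-Reasoning

    A : Carrier
    A = (𝟙 ⊕ X) ^ T

    coefficient : ℕ → ℤ
    coefficient k = (- (+ 1)) ℤ.^ k ℤ.* binomℤ n k

    ⊝A^k : ∀ k → (⊝ A) ^ k ≈ scale ((- (+ 1)) ℤ.^ k) ⊗ A ^ k
    ⊝A^k k = ≈-trans (^-congˡ k ⊝A≈-1A) (≈-trans (^-distrib-* _ A k) (*-congʳ (≈-sym (ι-^ (- (+ 1)) k))))
      where
      ⊝A≈-1A : ⊝ A ≈ scale (- (+ 1)) ⊗ A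
      ⊝A≈-1A = mk≃ λ v _ r → sym (ℤₚ.-1*i≡-i (act A v r))

    A^k⊗B : ∀ k → A ^ k ⊗ (𝟙 ⊕ X) ^ l ≈ (𝟙 ⊕ X) ^ (k ℕ.* T ℕ.+ l)
    A^k⊗B k = ≈-trans (*-congʳ (≈-trans (^-assocʳ (𝟙 ⊕ X) T k) (^-congʳ (𝟙 ⊕ X) (ℕₚ.*-comm T k))))
                      (≈-sym (^-homo-* (𝟙 ⊕ X) (k ℕ.* T) l))

    term : ∀ k → scale (+ (n C k)) ⊗ (⊝ A) ^ k ⊗ (𝟙 ⊕ X) ^ l ≈ scale (coefficient k) ⊗ (𝟙 ⊕ X) ^ (k ℕ.* T ℕ.+ l)
    term k = ≈-trans (*-congʳ (*-congˡ (⊝A^k k)))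
               (≈-trans (mk≃ λ v _ r → swap (+ (n C k)) ((- (+ 1)) ℤ.^ k) (act (A ^ k ⊗ (𝟙 ⊕ X) ^ l) v r))
                        (*-congˡ (A^k⊗B k)))
      where
      swap : ∀ c s x → c ℤ.* (s ℤ.* x) ≡ s ℤ.* c ℤ.* x
      swap = solve-∀

    expansion : (𝟙 ⊖ A) ^ n ⊗ (𝟙 ⊕ X) ^ l ≈ ∑[ k < suc n ] (scale (coefficient k) ⊗ (𝟙 ⊕ X) ^ (k ℕ.* T ℕ.+ l))
    expansion = ≈-trans (*-congʳ (binomial (⊝ A) n)) (≈-trans (*-distribʳ-∑< (suc n) _ _) (∑<-cong (suc n) term))

  ≈[mod]⇒≡[mod] : ∀ {a b K v} → Periodic v → a ≈ b [mod + K ] → ∀ r → act a v r ≡ act b v r [mod K ]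
  ≈[mod]⇒≡[mod] {a} {b} {K} {v} per (w , a⊖b≈Kw) r =
    ℤ∣.∣⇒∣ᵤ (ℤ∣.divides (act w v r) (trans (act-≡ a⊖b≈Kw v per r) (ℤₚ.*-comm (+ K) (act w v r))))

  -- ε / m is the projection onto the eigenspace {v | v (r − 1) = σ v r} of the shift.
  module Trace (σ : ℤ) (σ²≡1 : σ ℤ.* σ ≡ + 1) (σᵐ≡1 : σ ℤ.^ m ≡ + 1) where

    y : Carrier
    y = scale σ ⊗ X

    y^i≈σⁱXⁱ : ∀ i → y ^ i ≈ scale (σ ℤ.^ i) ⊗ X ^ i
    y^i≈σⁱXⁱ i = ≈-trans (^-distrib-* (scale σ) X i) (*-congʳ (≈-sym (ι-^ σ i)))

    y^m≈𝟙 : y ^ m ≈ 𝟙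
    y^m≈𝟙 = ≈-trans (y^i≈σⁱXⁱ m) (≈-trans (⊗-cong (ι-≡ σᵐ≡1) X^m≈𝟙) (*-identityˡ 𝟙))

    ε : Carrier
    ε = ∑[ i < m ] (y ^ i)

    open ScaledIdempotent m ε (trace²≈M·trace {m} y^m≈𝟙) public

    Xε≈σε : X ⊗ ε ≈ scale σ ⊗ ε
    Xε≈σε = begin
      X ⊗ ε                              ≈⟨ *-identityˡ (X ⊗ ε) ⟨
      𝟙 ⊗ (X ⊗ ε)                        ≈⟨ *-congʳ (≈-trans (ι-≡ (sym σ²≡1)) (ι-* σ σ)) ⟩
      (scale σ ⊗ scale σ) ⊗ (X ⊗ ε)      ≈⟨ regroup (scale σ) X ε ⟩
      scale σ ⊗ (y ⊗ ε)                  ≈⟨ *-congˡ (y-absorbed-by-trace {m} y^m≈𝟙) ⟩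
      scale σ ⊗ ε                        ∎
      where
      open ≈-Reasoning
      regroup : ∀ s x e → (s ⊗ s) ⊗ (x ⊗ e) ≈ s ⊗ ((s ⊗ x) ⊗ e)
      regroup = solve 3 (λ s x e → (s :* s) :* (x :* e) := s :* ((s :* x) :* e)) ≈-refl

    ε[1+X]≈[1+σ]ε : ε ⊗ (𝟙 ⊕ X) ≈ scale (+ 1 ℤ.+ σ) ⊗ ε
    ε[1+X]≈[1+σ]ε =
      ≈-trans (expand ε X) (≈-trans (+-congˡ Xε≈σε) (≈-trans (collect ε (scale σ)) (*-congʳ (≈-sym (ι-+ (+ 1) σ)))))
      where
      expand : ∀ e x → e ⊗ (𝟙 ⊕ x) ≈ e ⊕ x ⊗ e
      expand = solve 2 (λ e x → e :* (𝟏 :+ x) := e :+ x :* e) ≈-refl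
      collect : ∀ e s → e ⊕ s ⊗ e ≈ (𝟙 ⊕ s) ⊗ e
      collect = solve 2 (λ e s → e :+ s :* e := (𝟏 :+ s) :* e) ≈-refl

    act-ε-recurrence : ∀ r → act ε δ (r ℤ.- + 1) ≡ σ ℤ.* act ε δ r
    act-ε-recurrence = act-≡ Xε≈σε δ δ-periodic

    act-y^-origin : ∀ i → 0 < i → i < m → act (y ^ i) δ (+ 0) ≡ + 0
    act-y^-origin i 0<i i<m = begin
      act (y ^ i) δ (+ 0)                      ≡⟨ act-≡ (y^i≈σⁱXⁱ i) δ δ-periodic (+ 0) ⟩
      σ ℤ.^ i ℤ.* act (X ^ i) δ (+ 0)
        ≡⟨ cong (σ ℤ.^ i ℤ.*_) (trans (act-X^ i δ (+ 0)) (δ-vanishes i 0<i i<m)) ⟩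
      σ ℤ.^ i ℤ.* + 0                          ≡⟨ ℤₚ.*-zeroʳ (σ ℤ.^ i) ⟩
      + 0                                      ∎
      where open ≡-Reasoning

    act-ε-origin : 0 < m → act ε δ (+ 0) ≡ + 1
    act-ε-origin 0<m = partial-trace m 0<m ℕₚ.≤-refl
      where
      partial-trace : ∀ n → 0 < n → n ≤ m → act (∑[ i < n ] (y ^ i)) δ (+ 0) ≡ + 1
      partial-trace (suc n) _ 1+n≤m = trans (act-∑< n (y ^_) δ (+ 0))
        (trans (Σ≤-concentrated n _ (λ i 0<i i≤n → act-y^-origin i 0<i (ℕₚ.<-≤-trans (s≤s i≤n) 1+n≤m)))
               (trans (ℤₚ.*-identityˡ (δ (+ 0))) δ-origin))

    module _ {h : Carrier} (u≈h[1+X] : u ≈ h ⊗ (𝟙 ⊕ X)) where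

      alternating-sum-congruence : ∀ {q T} → Coprime q m → (d : NuData m q) → ν d ∣ T → ∀ l n r →
        (+ m) ℤ.* alternatingSum m T l (suc n) r
          ≡ ((+ 1 ℤ.+ σ) ℤ.^ l ℤ.* (+ 1 ℤ.- (+ 1 ℤ.+ σ) ℤ.^ T) ℤ.^ suc n) ℤ.* act ε δ r [mod q ℕ.^ suc n ]
      alternating-sum-congruence {q} {T} q⊥m d ν∣T l n r =
        subst (λ S → (+ m) ℤ.* S ≡ c ℤ.* act ε δ r [mod q ℕ.^ suc n ]) (act-alternating-sum (suc n) T l r)
          (≈[mod]⇒≡[mod] δ-periodic (subst (Z ≈ scale c ⊗ ε [mod_]) (sym (pos-^ q (suc n))) congruence) r)
        where
        c : ℤ
        c = (+ 1 ℤ.+ σ) ℤ.^ l ℤ.* (+ 1 ℤ.- (+ 1 ℤ.+ σ) ℤ.^ T) ℤ.^ suc n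

        Z : Carrier
        Z = scale (+ m) ⊗ ((𝟙 ⊖ (𝟙 ⊕ X) ^ T) ^ suc n ⊗ (𝟙 ⊕ X) ^ l)

        congruence : Z ≈ scale c ⊗ ε [mod (+ q) ℤ.^ suc n ]
        congruence = power-congruence n (comaximal-^ (suc n) n (coprime⇒comaximal q⊥m))
          (eigen-^ ε[1+X]≈[1+σ]ε T) (eigen-^ ε[1+X]≈[1+σ]ε l) (ν-congruence u≈h[1+X] X^m≈𝟙 q⊥m d ν∣T)

  module OddTrace (c : ℕ) (m≡1+2c : m ≡ suc (c ℕ.+ c)) where

    open Trace (+ 1) refl (ℤₚ.^-zeroˡ m) public

    [X^2]^[[1+c]*i]≈X^i : ∀ i → (X ^ 2) ^ (suc c ℕ.* i) ≈ X ^ i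
    [X^2]^[[1+c]*i]≈X^i i = begin
      (X ^ 2) ^ (suc c ℕ.* i)    ≈⟨ ^-assocʳ X 2 (suc c ℕ.* i) ⟩
      X ^ (2 ℕ.* (suc c ℕ.* i))  ≈⟨ ^-congʳ X exponent ⟩
      X ^ (i ℕ.+ m ℕ.* i)        ≈⟨ ^-homo-* X i (m ℕ.* i) ⟩
      X ^ i ⊗ X ^ (m ℕ.* i)      ≈⟨ *-congˡ (X^[m*j]≈𝟙 i) ⟩
      X ^ i ⊗ 𝟙                  ≈⟨ *-identityʳ (X ^ i) ⟩
      X ^ i                      ∎
      where
      open ≈-Reasoning
      exponent : 2 ℕ.* (suc c ℕ.* i) ≡ i ℕ.+ m ℕ.* i
      exponent = trans (ℕ-identity c i) (cong (λ m → i ℕ.+ m ℕ.* i) (sym m≡1+2c))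
        where
        ℕ-identity : ∀ c i → 2 ℕ.* (suc c ℕ.* i) ≡ i ℕ.+ suc (c ℕ.+ c) ℕ.* i
        ℕ-identity = solve-∀ℕ

    -- X = X^(m+1) = (X²)^(1+c), so each 1 − X^i is a multiple of 1 − X² = (1 − X)(1 + X).
    u-factorises : ∃ λ h → u ≈ h ⊗ (𝟙 ⊕ X)
    u-factorises = (𝟙 ⊖ X) ⊗ H , (begin
      scale (+ m) ⊖ ∑[ i < m ] (y ^ i)                       ≈⟨ +-congˡ (⊝-cong (∑<-cong m y^i≈)) ⟩
      scale (+ m) ⊖ ∑[ i < m ] ((X ^ 2) ^ (suc c ℕ.* i))     ≈⟨ ι⊖∑-factorises (X ^ 2) (suc c ℕ.*_) m ⟩
      (𝟙 ⊖ X ^ 2) ⊗ H                                        ≈⟨ difference-of-squares X H ⟩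
      (𝟙 ⊖ X) ⊗ H ⊗ (𝟙 ⊕ X)                                  ∎)
      where
      open ≈-Reasoning

      H : Carrier
      H = ∑[ i < m ] (∑[ j < suc c ℕ.* i ] ((X ^ 2) ^ j))

      y^i≈ : ∀ i → y ^ i ≈ (X ^ 2) ^ (suc c ℕ.* i)
      y^i≈ i = ≈-trans (^-congˡ i (*-identityˡ X)) (≈-sym ([X^2]^[[1+c]*i]≈X^i i))

      difference-of-squares : ∀ x H → (𝟙 ⊖ x ⊗ (x ⊗ 𝟙)) ⊗ H ≈ (𝟙 ⊖ x) ⊗ H ⊗ (𝟙 ⊕ x)
      difference-of-squares = solve 2 (λ x H → (𝟏 :- x :* (x :* 𝟏)) :* H := (𝟏 :- x) :* H :* (𝟏 :+ x)) ≈-refl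

    act-ε : ∀ r → act ε δ r ≡ + 1
    act-ε = recurrence-unique {+ 1} refl (act ε δ) (λ _ → + 1) act-ε-recurrence (λ _ → refl)
      (act-ε-origin (subst (0 <_) (sym m≡1+2c) (s≤s z≤n)))

  module EvenTrace (c : ℕ) (m≡2c : m ≡ c ℕ.+ c) where

    [-1]^m≡1 : (- (+ 1)) ℤ.^ m ≡ + 1
    [-1]^m≡1 = trans (cong ((- (+ 1)) ℤ.^_) (trans m≡2c (cong (c ℕ.+_) (sym (ℕₚ.+-identityʳ c)))))
                     (trans (sym (ℤₚ.^-*-assoc (- (+ 1)) 2 c)) (ℤₚ.^-zeroˡ c))

    open Trace (- (+ 1)) refl [-1]^m≡1 public

    u-factorises : ∃ λ h → u ≈ h ⊗ (𝟙 ⊕ X)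
    u-factorises = H , ≈-trans (ι⊖∑-factorises y (λ i → i) m) (≈-trans (*-congʳ 1-y≈1+X) (*-comm (𝟙 ⊕ X) H))
      where
      H : Carrier
      H = ∑[ i < m ] (∑[ j < i ] (y ^ j))

      1-y≈1+X : 𝟙 ⊖ y ≈ 𝟙 ⊕ X
      1-y≈1+X = ≈-trans (+-congˡ (⊝-cong (*-congʳ (ι-⊝ (+ 1))))) (flip X)
        where
        flip : ∀ x → 𝟙 ⊖ (⊝ 𝟙) ⊗ x ≈ 𝟙 ⊕ x
        flip = solve 1 (λ x → 𝟏 :- (:- 𝟏) :* x := 𝟏 :+ x) ≈-refl

    act-ε : 0 < m → ∀ r → act ε δ r ≡ minusOnePow r
    act-ε 0<m =
      recurrence-unique { - (+ 1)} refl (act ε δ) minusOnePow act-ε-recurrence minusOnePow-recurrence (act-ε-origin 0<m)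

  odd-congruence : ∀ {q T} → Coprime q m → (d : NuData m q) → ν d ∣ T → ¬ (2 ∣ m) → ∀ l n r →
    (+ m) ℤ.* alternatingSum m T l (suc n) r ≡ (+ 2) ℤ.^ l ℤ.* (+ 1 ℤ.- (+ 2) ℤ.^ T) ℤ.^ suc n [mod q ℕ.^ suc n ]
  odd-congruence {q} {T} q⊥m d ν∣T 2∤m l n r with odd⇒≡1+2c 2∤m
  ... | c , m≡1+2c =
    subst (λ x → (+ m) ℤ.* alternatingSum m T l (suc n) r ≡ x [mod q ℕ.^ suc n ])
      (trans (cong ((+ 2) ℤ.^ l ℤ.* (+ 1 ℤ.- (+ 2) ℤ.^ T) ℤ.^ suc n ℤ.*_) (act-ε r)) (ℤₚ.*-identityʳ _))
      (alternating-sum-congruence (proj₂ u-factorises) q⊥m d ν∣T l n r)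
    where open OddTrace c m≡1+2c

  even-congruence : ∀ {q T} → 0 < m → Coprime q m → (d : NuData m q) → ν d ∣ suc T → 2 ∣ m → ∀ l n r →
    (+ m) ℤ.* alternatingSum m (suc T) l (suc n) r ≡ δ0 l ℤ.* minusOnePow r [mod q ℕ.^ suc n ]
  even-congruence {q} {T} 0<m q⊥m d ν∣T 2∣m l n r with even⇒≡2c 2∣m
  ... | c , m≡2c =
    subst (λ x → (+ m) ℤ.* alternatingSum m (suc T) l (suc n) r ≡ x [mod q ℕ.^ suc n ])
      (cong₂ ℤ._*_ eigenvalue (act-ε 0<m r))
      (alternating-sum-congruence (proj₂ u-factorises) q⊥m d ν∣T l n r)
    where
    open EvenTrace c m≡2c

    eigenvalue : (+ 0) ℤ.^ l ℤ.* (+ 1 ℤ.- (+ 0) ℤ.^ suc T) ℤ.^ suc n ≡ δ0 l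
    eigenvalue = trans (cong ((+ 0) ℤ.^ l ℤ.*_) (ℤₚ.^-zeroˡ (suc n))) (trans (ℤₚ.*-identityʳ _) (0^l≡δ0 l))

theorem1p1 : (q m : ℕ) → 1 < q → 0 < m → Coprime q m →
    (d : NuData m q) → (T : ℕ) → 0 < T → ν d ∣ T →
    (l n : ℕ) → 1 ≤ n → (r : ℤ) →
      let S = Σ≤ n (λ k → ((- (+ 1)) ℤ.^ k) ℤ.* binomℤ n k ℤ.* binomSumMod m (ℕ._+_ (ℕ._*_ k T) l) r) in
      (¬ (2 ∣ m) → (+ m) ℤ.* S ≡ ((+ 2) ℤ.^ l) ℤ.* (((+ 1) ℤ.- ((+ 2) ℤ.^ T)) ℤ.^ n) [mod ℕ._^_ q n ])
      × (2 ∣ m → (+ m) ℤ.* S ≡ δ0 l ℤ.* minusOnePow r [mod ℕ._^_ q n ])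
theorem1p1 q m _ 0<m q⊥m d (suc T) _ ν∣T l (suc n) _ r =
  (λ 2∤m → odd-congruence q⊥m d ν∣T 2∤m l n r) , (λ 2∣m → even-congruence 0<m q⊥m d ν∣T 2∣m l n r)
  where open ShiftOperators m
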